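{- If a sequent $\Gamma\vdash\Delta$ is provable in $\mathrm{CLKID}^\omega$, then $\Gamma\vdash\Delta$ is provable in $\mathrm{CLKID}^\omega$ without using the substitution rule $(\mathrm{Subst})$.
   Context: $\mathrm{CLKID}^\omega$ is Brotherston's cyclic-proof system for first-order logic with inductive predicates ($\mathrm{FOL}_{\mathrm{ID}}$). Terms are built from variables and function symbols; formulas are built from inductive predicates $P(\vec t)$, ordinary predicates $Q(\vec u)$, equality $t=u$, $\lnot,\vee,\wedge,\to,\exists,\forall$. Inductive predicates are given by a finite set of productions $P(\vec t)\Leftarrow Q_1(\vec{u_1}),\dots,Q_n(\vec{u_n}),P_1(\vec{t_1}),\dots,P_m(\vec{t_m})$. A sequent is $\Gamma\vdash\Delta$ with $\Gamma,\Delta$ finite sets of formulas. The inference rules of $\mathrm{CLKID}^\omega$ are the usual LK-style rules: $(\mathrm{Axiom})$ (when $\Gamma\cap\Delta\neq\emptyset$), weakening $(\mathrm{Wk})$, $(\mathrm{Cut})$, the substitution rule $(\mathrm{Subst})$ deriving $\Gamma[\theta]\vdash\Delta[\theta]$ from $\Gamma\vdash\Delta$ for any substitution $\theta$ of terms for variables, left/right rules for $\lnot,\vee,\wedge,\to,\forall,\exists$ (with fresh eigenvariables for $(\forall\mathrm{R})$ and $(\exists\mathrm{L})$), equality rules $(=\mathrm{L})$ and $(=\mathrm{R})$, a left unfolding rule $(\mathrm{UL})$ for an inductive predicate $P(\vec u)$ in the antecedent whose premises are all case distinctions $\Gamma,\vec u=\vec t(\vec y),Q_1(\vec{u_1}(\vec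 y)),\dots,P_m(\vec{t_m}(\vec y))\vdash\Delta$ (one for each production of $P$, with $\vec y$ fresh), and a right unfolding rule $(\mathrm{UR})$ for $P$ in the succedent using one production. A pre-proof of $\mathrm{CLKID}^\omega$ is a finite derivation tree in which every non-axiom leaf (a bud) is assigned an internal node (its companion) labelled with a syntactically identical sequent. Paths follow the tree edges plus bud-to-companion edges. A trace along a path is a sequence of inductive-predicate occurrences in the antecedents, following the occurrence through each rule, and it progresses at a point where the occurrence is unfolded by $(\mathrm{UL})$. A pre-proof is a proof if it satisfies the global trace condition: every infinite path has a tail along which some trace progresses infinitely often. -}

module Defs where

open import Data.Nat using (ℕ; zero; suc; _≤_; _<_; _≟_)
open import Data.Fin using (Fin; zero; suc)
open import Data.Bool using (Bool; true; false)
open import Data.Maybe using (Maybe; just; nothing; _>>=_)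
open import Data.List using (List; []; _∷_; _++_; [_]; map; length; concat)
open import Data.Vec using (Vec; []; _∷_; toList)
open import Data.Product using (Σ; Σ-syntax; _×_; _,_; proj₁; proj₂)
open import Data.Sum using (_⊎_)
open import Data.Empty using (⊥)
open import Data.Unit using (⊤)
open import Relation.Nullary using (¬_; yes; no)
open import Relation.Binary.PropositionalEquality using (_≡_)
open import Data.List.Membership.Propositional using (_∈_; _∉_)
open import Data.List.Relation.Binary.Subset.Propositional using (_⊆_)
open import Data.List.Relation.Binary.Pointwise using (Pointwise)
open import Data.List.Relation.Unary.All using (All)

record Signature : Set₁ where
  field
    Fun   : Set
    arity : Fun → ℕ
    OPred : Set
    oar   : OPred → ℕ
    nInd  : ℕ
    iar   : Fin nInd → ℕ

module CLKID (sig : Signature) where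

  open Signature sig

  IPred : Set
  IPred = Fin nInd

  -- Terms and formulas (locally nameless):
  -- free variables are named by ℕ; bound variables are de Bruijn
  -- LEVELS  bvar i : Term n  (i counted from the outermost binder).

  data Term (n : ℕ) : Set where
    var  : ℕ → Term n
    bvar : Fin n → Term n
    app  : (f : Fun) → Vec (Term n) (arity f) → Term n

  data Formula (n : ℕ) : Set where
    ind : (P : IPred) → Vec (Term n) (iar P) → Formula n
    ord : (Q : OPred) → Vec (Term n) (oar Q) → Formula n
    eq  : Term n → Term n → Formula n
    neg : Formula n → Formula n
    or  : Formula n → Formula n → Formula n
    and : Formula n → Formula n → Formula n
    imp : Formula n → Formula n → Formula n
    ex  : Formula (suc n) → Formula n
    all : Formula (suc n) → Formula n

  Subst : Set
  Subst = ℕ → Term 0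

  mutual
    wk0 : ∀ {n} → Term 0 → Term n
    wk0 (var x)    = var x
    wk0 (bvar ())
    wk0 (app f ts) = app f (wk0s ts)

    wk0s : ∀ {n k} → Vec (Term 0) k → Vec (Term n) k
    wk0s []       = []
    wk0s (t ∷ ts) = wk0 t ∷ wk0s ts

  mutual
    substT : ∀ {n} → Subst → Term n → Term n
    substT θ (var x)    = wk0 (θ x)
    substT θ (bvar i)   = bvar i
    substT θ (app f ts) = app f (substTs θ ts)

    substTs : ∀ {n k} → Subst → Vec (Term n) k → Vec (Term n) k
    substTs θ []       = []
    substTs θ (t ∷ ts) = substT θ t ∷ substTs θ ts

  substF : ∀ {n} → Subst → Formula n → Formula n
  substF θ (ind P ts) = ind P (substTs θ ts)
  substF θ (ord Q ts) = ord Q (substTs θ ts)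
  substF θ (eq t u)   = eq (substT θ t) (substT θ u)
  substF θ (neg φ)    = neg (substF θ φ)
  substF θ (or φ ψ)   = or (substF θ φ) (substF θ ψ)
  substF θ (and φ ψ)  = and (substF θ φ) (substF θ ψ)
  substF θ (imp φ ψ)  = imp (substF θ φ) (substF θ ψ)
  substF θ (ex φ)     = ex (substF θ φ)
  substF θ (all φ)    = all (substF θ φ)

  ren : (ℕ → ℕ) → Subst
  ren ρ x = var (ρ x)

  [_/_,_/_] : Term 0 → ℕ → Term 0 → ℕ → Subst
  [ t / x , u / y ] z with z ≟ x
  ... | yes _ = t
  ... | no _ with z ≟ y
  ...   | yes _ = u
  ...   | no _  = var z

  -- instantiating the outermost bound variable by a term
  mutual
    instT : ∀ {n} → Term 0 → Term (suc n) → Term n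
    instT t (var x)        = var x
    instT t (bvar zero)    = wk0 t
    instT t (bvar (suc i)) = bvar i
    instT t (app f ts)     = app f (instTs t ts)

    instTs : ∀ {n k} → Term 0 → Vec (Term (suc n)) k → Vec (Term n) k
    instTs t []       = []
    instTs t (u ∷ us) = instT t u ∷ instTs t us

  instF : ∀ {n} → Term 0 → Formula (suc n) → Formula n
  instF t (ind P ts) = ind P (instTs t ts)
  instF t (ord Q ts) = ord Q (instTs t ts)
  instF t (eq u v)   = eq (instT t u) (instT t v)
  instF t (neg φ)    = neg (instF t φ)
  instF t (or φ ψ)   = or (instF t φ) (instF t ψ)
  instF t (and φ ψ)  = and (instF t φ) (instF t ψ)
  instF t (imp φ ψ)  = imp (instF t φ) (instF t ψ)
  instF t (ex φ)     = ex (instF t φ)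
  instF t (all φ)    = all (instF t φ)

  mutual
    fvT : ∀ {n} → Term n → List ℕ
    fvT (var x)    = x ∷ []
    fvT (bvar i)   = []
    fvT (app f ts) = fvTs ts

    fvTs : ∀ {n k} → Vec (Term n) k → List ℕ
    fvTs []       = []
    fvTs (t ∷ ts) = fvT t ++ fvTs ts

  fvF : ∀ {n} → Formula n → List ℕ
  fvF (ind P ts) = fvTs ts
  fvF (ord Q ts) = fvTs ts
  fvF (eq t u)   = fvT t ++ fvT u
  fvF (neg φ)    = fvF φ
  fvF (or φ ψ)   = fvF φ ++ fvF ψ
  fvF (and φ ψ)  = fvF φ ++ fvF ψ
  fvF (imp φ ψ)  = fvF φ ++ fvF ψ
  fvF (ex φ)     = fvF φ
  fvF (all φ)    = fvF φ

  -- Sequents Γ ⊢ Δ; Γ, Δ are finite SETS of (bound-variable-free)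
  -- formulas, represented by lists compared up to set equality.

  record Seq : Set where
    constructor _⊢_
    field
      ante : List (Formula 0)
      succ : List (Formula 0)
  open Seq public

  _≈S_ : Seq → Seq → Set
  S ≈S S' = (ante S ⊆ ante S' × ante S' ⊆ ante S)
          × (succ S ⊆ succ S' × succ S' ⊆ succ S)

  fvList : List (Formula 0) → List ℕ
  fvList Γ = concat (map fvF Γ)

  fvSeq : Seq → List ℕ
  fvSeq (Γ ⊢ Δ) = fvList Γ ++ fvList Δ

  substL : Subst → List (Formula 0) → List (Formula 0)
  substL θ = map (substF θ)

  OAtom : Set
  OAtom = Σ OPred λ Q → Vec (Term 0) (oar Q)

  IAtom : Set
  IAtom = Σ IPred λ P → Vec (Term 0) (iar P)

  oatom : OAtom → Formula 0
  oatom (Q , us) = ord Q us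

  iatom : IAtom → Formula 0
  iatom (P , ts) = ind P ts

  record Prod (P : IPred) : Set where
    field
      headArgs : Vec (Term 0) (iar P)
      ordBody  : List OAtom
      indBody  : List IAtom
  open Prod public

  ordBodyF : ∀ {P} → Subst → Prod P → List (Formula 0)
  ordBodyF θ pr = map (λ a → substF θ (oatom a)) (ordBody pr)

  indBodyF : ∀ {P} → Subst → Prod P → List (Formula 0)
  indBodyF θ pr = map (λ a → substF θ (iatom a)) (indBody pr)

  varsProd : ∀ {P} → Prod P → List ℕ
  varsProd pr = fvTs (headArgs pr)
             ++ concat (map (λ a → fvF (oatom a)) (ordBody pr))
             ++ concat (map (λ a → fvF (iatom a)) (indBody pr))

  InductiveDefs : Set
  InductiveDefs = (P : IPred) → List (Prod P)

  nth : ∀ {A : Set} → List A → ℕ → Maybe A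
  nth []       _       = nothing
  nth (x ∷ xs) zero    = just x
  nth (x ∷ xs) (suc j) = nth xs j

  zipEq : ∀ {k} → Vec (Term 0) k → Vec (Term 0) k → List (Formula 0)
  zipEq []       []       = []
  zipEq (u ∷ us) (t ∷ ts) = eq u t ∷ zipEq us ts

  InjectiveOn : (ℕ → ℕ) → List ℕ → Set
  InjectiveOn ρ xs = ∀ x y → x ∈ xs → y ∈ xs → ρ x ≡ ρ y → x ≡ y

  module Rules (Φ : InductiveDefs) where

    -- premises of (UL) for  Γ, P(u⃗) ⊢ Δ; the j-th production of P
    -- is instantiated with the variable renaming ρ j
    ulPrems : ∀ {P} → List (Formula 0) → List (Formula 0) →
              Vec (Term 0) (iar P) → (ℕ → ℕ → ℕ) → ℕ →
              List (Prod P) → List Seq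
    ulPrems Γ Δ us ρ j [] = []
    ulPrems Γ Δ us ρ j (pr ∷ prs) =
      ((zipEq us (substTs (ren (ρ j)) (headArgs pr))
         ++ ordBodyF (ren (ρ j)) pr ++ indBodyF (ren (ρ j)) pr ++ Γ) ⊢ Δ)
      ∷ ulPrems Γ Δ us ρ (suc j) prs

    urPrems : ∀ {P} → List (Formula 0) → List (Formula 0) → Subst →
              Prod P → List Seq
    urPrems Γ Δ θ pr =
      map (λ φ → Γ ⊢ (φ ∷ Δ)) (ordBodyF θ pr ++ indBodyF θ pr)

    -- Rule instances: Inst S ps  means  S  follows from premises  ps
    data Inst : Seq → List Seq → Set where
      axiom : ∀ {Γ Δ} (φ : Formula 0) → φ ∈ Γ → φ ∈ Δ → Inst (Γ ⊢ Δ) []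
      wk    : ∀ {Γ Δ Γ' Δ'} → Γ' ⊆ Γ → Δ' ⊆ Δ →
              Inst (Γ ⊢ Δ) [ Γ' ⊢ Δ' ]
      cut   : ∀ Γ Δ φ → Inst (Γ ⊢ Δ) ((Γ ⊢ (φ ∷ Δ)) ∷ ((φ ∷ Γ) ⊢ Δ) ∷ [])
      subst : ∀ Γ Δ (θ : Subst) →
              Inst (substL θ Γ ⊢ substL θ Δ) [ Γ ⊢ Δ ]
      negL  : ∀ Γ Δ φ → Inst ((neg φ ∷ Γ) ⊢ Δ) [ Γ ⊢ (φ ∷ Δ) ]
      negR  : ∀ Γ Δ φ → Inst (Γ ⊢ (neg φ ∷ Δ)) [ (φ ∷ Γ) ⊢ Δ ]
      orL   : ∀ Γ Δ φ ψ → Inst ((or φ ψ ∷ Γ) ⊢ Δ)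
                               (((φ ∷ Γ) ⊢ Δ) ∷ ((ψ ∷ Γ) ⊢ Δ) ∷ [])
      orR   : ∀ Γ Δ φ ψ → Inst (Γ ⊢ (or φ ψ ∷ Δ)) [ Γ ⊢ (φ ∷ ψ ∷ Δ) ]
      andL  : ∀ Γ Δ φ ψ → Inst ((and φ ψ ∷ Γ) ⊢ Δ) [ (φ ∷ ψ ∷ Γ) ⊢ Δ ]
      andR  : ∀ Γ Δ φ ψ → Inst (Γ ⊢ (and φ ψ ∷ Δ))
                               ((Γ ⊢ (φ ∷ Δ)) ∷ (Γ ⊢ (ψ ∷ Δ)) ∷ [])
      impL  : ∀ Γ Δ φ ψ → Inst ((imp φ ψ ∷ Γ) ⊢ Δ)
                               ((Γ ⊢ (φ ∷ Δ)) ∷ ((ψ ∷ Γ) ⊢ Δ) ∷ [])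
      impR  : ∀ Γ Δ φ ψ → Inst (Γ ⊢ (imp φ ψ ∷ Δ)) [ (φ ∷ Γ) ⊢ (ψ ∷ Δ) ]
      allL  : ∀ Γ Δ φ (t : Term 0) →
              Inst ((all φ ∷ Γ) ⊢ Δ) [ (instF t φ ∷ Γ) ⊢ Δ ]
      allR  : ∀ Γ Δ φ (z : ℕ) → z ∉ fvSeq (Γ ⊢ (all φ ∷ Δ)) →
              Inst (Γ ⊢ (all φ ∷ Δ)) [ Γ ⊢ (instF (var z) φ ∷ Δ) ]
      exL   : ∀ Γ Δ φ (z : ℕ) → z ∉ fvSeq ((ex φ ∷ Γ) ⊢ Δ) →
              Inst ((ex φ ∷ Γ) ⊢ Δ) [ (instF (var z) φ ∷ Γ) ⊢ Δ ]
      exR   : ∀ Γ Δ φ (t : Term 0) →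
              Inst (Γ ⊢ (ex φ ∷ Δ)) [ Γ ⊢ (instF t φ ∷ Δ) ]
      eqL   : ∀ Γ Δ (x y : ℕ) (t u : Term 0) →
              Inst ((eq t u ∷ substL [ t / x , u / y ] Γ)
                      ⊢ substL [ t / x , u / y ] Δ)
                   [ substL [ u / x , t / y ] Γ ⊢ substL [ u / x , t / y ] Δ ]
      eqR   : ∀ Γ Δ (t : Term 0) → Inst (Γ ⊢ (eq t t ∷ Δ)) []
      unfoldL : ∀ Γ Δ (P : IPred) (us : Vec (Term 0) (iar P))
                (ρ : ℕ → ℕ → ℕ) →
                (∀ j pr → nth (Φ P) j ≡ just pr →
                   InjectiveOn (ρ j) (varsProd pr)
                   × (∀ x → x ∈ varsProd pr →
                        ρ j x ∉ fvSeq ((ind P us ∷ Γ) ⊢ Δ))) →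
                Inst ((ind P us ∷ Γ) ⊢ Δ) (ulPrems Γ Δ us ρ 0 (Φ P))
      unfoldR : ∀ Γ Δ (P : IPred) (pr : Prod P) → pr ∈ Φ P → (θ : Subst) →
                Inst (Γ ⊢ (ind P (substTs θ (headArgs pr)) ∷ Δ))
                     (urPrems Γ Δ θ pr)

    -- Trace pairs: TracePair r j τ τ' b  says (τ, τ') is a trace pair
    -- from the conclusion of r to its j-th premise; b = true iff it is
    -- progressing.
    TracePair : ∀ {S ps} → Inst S ps → ℕ → Formula 0 → Formula 0 → Bool → Set
    TracePair (subst Γ Δ θ) j τ τ' b = b ≡ false × τ ≡ substF θ τ'
    TracePair (eqL Γ Δ x y t u) j τ τ' b =
      b ≡ false × Σ (Formula 0) λ F →
        τ ≡ substF [ t / x , u / y ] F × τ' ≡ substF [ u / x , t / y ] F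
    TracePair (unfoldL Γ Δ P us ρ _) j τ τ' b =
      (b ≡ false × τ ≡ τ')
      ⊎ (b ≡ true × τ ≡ ind P us ×
          Σ (Prod P) λ pr → nth (Φ P) j ≡ just pr
                           × τ' ∈ indBodyF (ren (ρ j)) pr)
    TracePair _ j τ τ' b = b ≡ false × τ ≡ τ'

    -- Finite derivation trees; leaves that are not axioms are buds.
    data Tree : Set where
      bud  : Seq → Tree
      node : (S : Seq) {S' : Seq} {ps : List Seq} → Inst S' ps →
             List Tree → Tree

    concl : Tree → Seq
    concl (bud S)        = S
    concl (node S r ch)  = S

    mutual
      WF : Tree → Set
      WF (bud S) = ⊤
      WF (node S {S'} {ps} r ch) =
        S ≈S S' × Pointwise (λ c p → concl c ≈S p) ch ps × WFs ch

      WFs : List Tree → Set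
      WFs []       = ⊤
      WFs (c ∷ cs) = WF c × WFs cs

    -- subtree at a position (list of child indices from the root)
    mutual
      at : Tree → List ℕ → Maybe Tree
      at t [] = just t
      at (bud S) (_ ∷ _) = nothing
      at (node S r ch) (j ∷ p) = atL ch j p

      atL : List Tree → ℕ → List ℕ → Maybe Tree
      atL [] j p = nothing
      atL (c ∷ cs) zero p = at c p
      atL (c ∷ cs) (suc j) p = atL cs j p

    IsNode : Tree → Set
    IsNode (bud S) = ⊥
    IsNode (node S r []) = ⊥
    IsNode (node S r (_ ∷ _)) = ⊤

    CompanionOK : Tree → List ℕ → Seq → Set
    CompanionOK T q S =
      Σ Tree λ c → at T q ≡ just c × IsNode c × concl c ≈S S

    record PreProof (S : Seq) : Set where
      field
        tree     : Tree
        wf       : WF tree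
        rootSeq  : concl tree ≈S S
        comp     : List ℕ → List ℕ
        compOK   : ∀ p S' → at tree p ≡ just (bud S') →
                   CompanionOK tree (comp p) S'
    open PreProof public

    EdgeAt : Maybe Tree → (List ℕ → List ℕ) → List ℕ → List ℕ → Set
    EdgeAt nothing comp p q = ⊥
    EdgeAt (just (bud S)) comp p q = q ≡ comp p
    EdgeAt (just (node S r ch)) comp p q =
      Σ ℕ λ j → j < length ch × q ≡ p ++ [ j ]

    TraceEdgeAt : Maybe Tree → (List ℕ → List ℕ) → List ℕ → List ℕ →
                  Formula 0 → Formula 0 → Bool → Set
    TraceEdgeAt nothing comp p q τ τ' b = ⊥
    TraceEdgeAt (just (bud S)) comp p q τ τ' b =
      q ≡ comp p × τ ≡ τ' × b ≡ false
    TraceEdgeAt (just (node S r ch)) comp p q τ τ' b =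
      Σ ℕ λ j → j < length ch × q ≡ p ++ [ j ] × TracePair r j τ τ' b

    IsIndAtom : Formula 0 → Set
    IsIndAtom τ = Σ IPred λ P → Σ (Vec (Term 0) (iar P)) λ us → τ ≡ ind P us

    InAnte : Tree → List ℕ → Formula 0 → Set
    InAnte T p τ = Σ Tree λ c → at T p ≡ just c × τ ∈ ante (concl c)

    IsInfinitePath : ∀ {S} → PreProof S → (ℕ → List ℕ) → Set
    IsInfinitePath D π =
      ∀ i → EdgeAt (at (tree D) (π i)) (comp D) (π i) (π (suc i))

    HasInfProgTrace : ∀ {S} → PreProof S → (ℕ → List ℕ) → Set
    HasInfProgTrace D π =
      Σ ℕ λ k → Σ (ℕ → Formula 0) λ τ → Σ (ℕ → Bool) λ b →
        (∀ i → k ≤ i →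
           IsIndAtom (τ i)
           × InAnte (tree D) (π i) (τ i)
           × TraceEdgeAt (at (tree D) (π i)) (comp D) (π i) (π (suc i))
                         (τ i) (τ (suc i)) (b i))
        × (∀ m → Σ ℕ λ j → m ≤ j × k ≤ j × b j ≡ true)

    GlobalTraceCondition : ∀ {S} → PreProof S → Set
    GlobalTraceCondition D =
      ∀ π → IsInfinitePath D π → HasInfProgTrace D π

    NoSubstInst : ∀ {S ps} → Inst S ps → Set
    NoSubstInst (subst _ _ _) = ⊥
    NoSubstInst _ = ⊤

    mutual
      SubstFree : Tree → Set
      SubstFree (bud S) = ⊤
      SubstFree (node S r ch) = NoSubstInst r × SubstFreeL ch

      SubstFreeL : List Tree → Set
      SubstFreeL [] = ⊤
      SubstFreeL (c ∷ cs) = SubstFree c × SubstFreeL cs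

    Provable : Seq → Set
    Provable S = Σ (PreProof S) GlobalTraceCondition

    ProvableWithoutSubst : Seq → Set
    ProvableWithoutSubst S =
      Σ (PreProof S) λ D → GlobalTraceCondition D × SubstFree (tree D)

-- Each (Subst) node, deriving Γθ ⊢ Δθ from Γ ⊢ Δ, is replaced by a derivation using only (Cut),
-- (∃R), (=R), (∃L) and (=L).  On the free variables of Γ ⊢ Δ, θ agrees with a composite of single
-- replacements [s/v] with v ∉ FV(s) (rename the variables apart, then instantiate them), and one
-- such replacement is a cut on ∃z. s = z: its left premise is closed by (∃R) and (=R), while on
-- its right premise (∃L) with eigenvariable v followed by (=L) on s = v returns to the sequent
-- before the replacement.  Buds and companions are carried over, so an infinite path of the new
-- pre-proof is, from some point on, an infinite path of the old one with every (Subst) step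
-- stretched along the spine of its simulation.  An old trace, read through the replacements along
-- each spine, becomes a trace of the new path progressing at the same (UL) steps, so the global
-- trace condition is preserved.

module Submission where

open import Defs
open import Data.Bool using (Bool; true; false)
open import Data.Empty using (⊥; ⊥-elim)
open import Data.Fin using (Fin)
open import Data.List using (List; []; _∷_; _++_; [_]; map; concatMap; upTo; length; drop)
open import Data.List.Extrema.Nat using (max; xs≤max)
open import Data.List.Membership.Propositional using (_∈_; _∉_)
open import Data.List.Membership.Propositional.Properties
  using (∈-++⁺ˡ; ∈-++⁺ʳ; ∈-++⁻; ∈-concat⁺′; ∈-map⁺; ∈-concatMap⁺; ∈-upTo⁺)
open import Data.List.NonEmpty as List⁺ using (List⁺; toList)
open import Data.List.Properties
  using (map-∘; map-id; map-cong-local; ++-assoc; ++-identityʳ; ∷ʳ-injective)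
open import Data.List.Relation.Binary.Pointwise using (Pointwise; []; _∷_)
open import Data.List.Relation.Binary.Subset.Propositional.Properties using (⊆-refl; ⊆-trans)
open import Data.List.Relation.Unary.All as All using (All; []; _∷_)
open import Data.List.Relation.Unary.All.Properties as All using ()
open import Data.List.Relation.Unary.Any as Any using (Any; here; there)
open import Data.List.Relation.Unary.Any.Properties as Any using ()
open import Data.Maybe using (just; nothing)
open import Data.Maybe.Properties using (just-injective)
open import Data.Nat
  using (ℕ; zero; suc; _≤_; _<_; _≟_; _+_; _∸_; z≤n; s≤s; s≤s⁻¹; _<?_; _≤?_)
open import Data.Nat.Properties
open import Data.Product using (Σ-syntax; _×_; _,_; proj₁; proj₂; map₂)
open import Data.Sum using (_⊎_; inj₁; inj₂)
open import Data.Unit using (tt)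
open import Data.Vec using (Vec; []; _∷_)
open import Function using (_∘_)
open import Relation.Binary.Definitions using (tri<; tri≈; tri>)
open import Relation.Binary.PropositionalEquality hiding ([_]) renaming (subst to ≡-subst)
open import Relation.Nullary using (Dec; yes; no)

module Substitution (sig : Signature) where
  open CLKID sig

  Agree : Subst → Subst → List ℕ → Set
  Agree σ σ′ xs = ∀ x → x ∈ xs → σ x ≡ σ′ x

  Agree-++ˡ : ∀ {σ σ′} xs {ys} → Agree σ σ′ (xs ++ ys) → Agree σ σ′ xs
  Agree-++ˡ xs agree x x∈xs = agree x (∈-++⁺ˡ x∈xs)

  Agree-++ʳ : ∀ {σ σ′} xs {ys} → Agree σ σ′ (xs ++ ys) → Agree σ σ′ ys
  Agree-++ʳ xs agree x x∈ys = agree x (∈-++⁺ʳ xs x∈ys)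

  mutual
    wk0-id : (t : Term 0) → wk0 t ≡ t
    wk0-id (var x)    = refl
    wk0-id (bvar ())
    wk0-id (app f ts) = cong (app f) (wk0s-id ts)

    wk0s-id : ∀ {k} (ts : Vec (Term 0) k) → wk0s ts ≡ ts
    wk0s-id []       = refl
    wk0s-id (t ∷ ts) = cong₂ _∷_ (wk0-id t) (wk0s-id ts)

  mutual
    instT-wk0 : ∀ {n} (u t : Term 0) → instT u (wk0 {suc n} t) ≡ wk0 t
    instT-wk0 u (var x)    = refl
    instT-wk0 u (bvar ())
    instT-wk0 u (app f ts) = cong (app f) (instTs-wk0s u ts)

    instTs-wk0s : ∀ {n k} (u : Term 0) (ts : Vec (Term 0) k) →
                  instTs u (wk0s {suc n} ts) ≡ wk0s ts
    instTs-wk0s u []       = refl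
    instTs-wk0s u (t ∷ ts) = cong₂ _∷_ (instT-wk0 u t) (instTs-wk0s u ts)

  mutual
    fvT-wk0 : ∀ {n} (t : Term 0) → fvT (wk0 {n} t) ≡ fvT t
    fvT-wk0 (var x)    = refl
    fvT-wk0 (bvar ())
    fvT-wk0 (app f ts) = fvTs-wk0s ts

    fvTs-wk0s : ∀ {n k} (ts : Vec (Term 0) k) → fvTs (wk0s {n} ts) ≡ fvTs ts
    fvTs-wk0s []       = refl
    fvTs-wk0s (t ∷ ts) = cong₂ _++_ (fvT-wk0 t) (fvTs-wk0s ts)

  mutual
    substT-wk0 : ∀ {n} σ (t : Term 0) → substT σ (wk0 {n} t) ≡ wk0 (substT σ t)
    substT-wk0 σ (var x)    = sym (cong wk0 (wk0-id (σ x)))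
    substT-wk0 σ (bvar ())
    substT-wk0 σ (app f ts) = cong (app f) (substTs-wk0s σ ts)

    substTs-wk0s : ∀ {n k} σ (ts : Vec (Term 0) k) →
                   substTs σ (wk0s {n} ts) ≡ wk0s (substTs σ ts)
    substTs-wk0s σ []       = refl
    substTs-wk0s σ (t ∷ ts) = cong₂ _∷_ (substT-wk0 σ t) (substTs-wk0s σ ts)

  substT-var : ∀ σ x → substT σ (var x) ≡ σ x
  substT-var σ x = wk0-id (σ x)

  mutual
    substT-cong : ∀ {n σ σ′} (t : Term n) → Agree σ σ′ (fvT t) →
                  substT σ t ≡ substT σ′ t
    substT-cong (var x)    agree = cong wk0 (agree x (here refl))
    substT-cong (bvar i)   agree = refl
    substT-cong (app f ts) agree = cong (app f) (substTs-cong ts agree)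

    substTs-cong : ∀ {n k σ σ′} (ts : Vec (Term n) k) → Agree σ σ′ (fvTs ts) →
                   substTs σ ts ≡ substTs σ′ ts
    substTs-cong []       agree = refl
    substTs-cong (t ∷ ts) agree =
      cong₂ _∷_ (substT-cong t (Agree-++ˡ (fvT t) agree))
                (substTs-cong ts (Agree-++ʳ (fvT t) agree))

  substF-cong : ∀ {n σ σ′} (F : Formula n) → Agree σ σ′ (fvF F) →
                substF σ F ≡ substF σ′ F
  substF-cong (ind P ts) agree = cong (ind P) (substTs-cong ts agree)
  substF-cong (ord Q ts) agree = cong (ord Q) (substTs-cong ts agree)
  substF-cong (eq t u)   agree =
    cong₂ eq (substT-cong t (Agree-++ˡ (fvT t) agree))
             (substT-cong u (Agree-++ʳ (fvT t) agree))
  substF-cong (neg F)    agree = cong neg (substF-cong F agree)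
  substF-cong (or F G)   agree =
    cong₂ or (substF-cong F (Agree-++ˡ (fvF F) agree))
             (substF-cong G (Agree-++ʳ (fvF F) agree))
  substF-cong (and F G)  agree =
    cong₂ and (substF-cong F (Agree-++ˡ (fvF F) agree))
              (substF-cong G (Agree-++ʳ (fvF F) agree))
  substF-cong (imp F G)  agree =
    cong₂ imp (substF-cong F (Agree-++ˡ (fvF F) agree))
              (substF-cong G (Agree-++ʳ (fvF F) agree))
  substF-cong (ex F)     agree = cong ex (substF-cong F agree)
  substF-cong (all F)    agree = cong all (substF-cong F agree)

  mutual
    substT-id : ∀ {n} (t : Term n) → substT var t ≡ t
    substT-id (var x)    = refl
    substT-id (bvar i)   = refl
    substT-id (app f ts) = cong (app f) (substTs-id ts)

    substTs-id : ∀ {n k} (ts : Vec (Term n) k) → substTs var ts ≡ ts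
    substTs-id []       = refl
    substTs-id (t ∷ ts) = cong₂ _∷_ (substT-id t) (substTs-id ts)

  substF-id : ∀ {n} (F : Formula n) → substF var F ≡ F
  substF-id (ind P ts) = cong (ind P) (substTs-id ts)
  substF-id (ord Q ts) = cong (ord Q) (substTs-id ts)
  substF-id (eq t u)   = cong₂ eq (substT-id t) (substT-id u)
  substF-id (neg F)    = cong neg (substF-id F)
  substF-id (or F G)   = cong₂ or (substF-id F) (substF-id G)
  substF-id (and F G)  = cong₂ and (substF-id F) (substF-id G)
  substF-id (imp F G)  = cong₂ imp (substF-id F) (substF-id G)
  substF-id (ex F)     = cong ex (substF-id F)
  substF-id (all F)    = cong all (substF-id F)

  infixr 9 _⊙_
  _⊙_ : Subst → Subst → Subst
  (σ ⊙ τ) x = substT σ (τ x)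

  mutual
    substT-⊙ : ∀ {n} σ τ (t : Term n) → substT σ (substT τ t) ≡ substT (σ ⊙ τ) t
    substT-⊙ σ τ (var x)    = substT-wk0 σ (τ x)
    substT-⊙ σ τ (bvar i)   = refl
    substT-⊙ σ τ (app f ts) = cong (app f) (substTs-⊙ σ τ ts)

    substTs-⊙ : ∀ {n k} σ τ (ts : Vec (Term n) k) →
                substTs σ (substTs τ ts) ≡ substTs (σ ⊙ τ) ts
    substTs-⊙ σ τ []       = refl
    substTs-⊙ σ τ (t ∷ ts) = cong₂ _∷_ (substT-⊙ σ τ t) (substTs-⊙ σ τ ts)

  substF-⊙ : ∀ {n} σ τ (F : Formula n) → substF σ (substF τ F) ≡ substF (σ ⊙ τ) F
  substF-⊙ σ τ (ind P ts) = cong (ind P) (substTs-⊙ σ τ ts)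
  substF-⊙ σ τ (ord Q ts) = cong (ord Q) (substTs-⊙ σ τ ts)
  substF-⊙ σ τ (eq t u)   = cong₂ eq (substT-⊙ σ τ t) (substT-⊙ σ τ u)
  substF-⊙ σ τ (neg F)    = cong neg (substF-⊙ σ τ F)
  substF-⊙ σ τ (or F G)   = cong₂ or (substF-⊙ σ τ F) (substF-⊙ σ τ G)
  substF-⊙ σ τ (and F G)  = cong₂ and (substF-⊙ σ τ F) (substF-⊙ σ τ G)
  substF-⊙ σ τ (imp F G)  = cong₂ imp (substF-⊙ σ τ F) (substF-⊙ σ τ G)
  substF-⊙ σ τ (ex F)     = cong ex (substF-⊙ σ τ F)
  substF-⊙ σ τ (all F)    = cong all (substF-⊙ σ τ F)

  OccursVia : Subst → List ℕ → ℕ → Set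
  OccursVia σ xs z = Any (λ y → z ∈ fvT (σ y)) xs

  occursVia-++ : ∀ {z} σ xs {ys xs′ ys′} →
                 (z ∈ xs → OccursVia σ xs′ z) → (z ∈ ys → OccursVia σ ys′ z) →
                 z ∈ xs ++ ys → OccursVia σ (xs′ ++ ys′) z
  occursVia-++ σ xs f g z∈ with ∈-++⁻ xs z∈
  ... | inj₁ z∈xs = Any.++⁺ˡ (f z∈xs)
  ... | inj₂ z∈ys = Any.++⁺ʳ _ (g z∈ys)

  mutual
    fvT-substT⁻ : ∀ {n z} σ (t : Term n) → z ∈ fvT (substT σ t) → OccursVia σ (fvT t) z
    fvT-substT⁻ σ (var x)    z∈ = here (≡-subst (_ ∈_) (fvT-wk0 (σ x)) z∈)
    fvT-substT⁻ σ (bvar i)   ()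
    fvT-substT⁻ σ (app f ts) z∈ = fvTs-substTs⁻ σ ts z∈

    fvTs-substTs⁻ : ∀ {n k z} σ (ts : Vec (Term n) k) →
                    z ∈ fvTs (substTs σ ts) → OccursVia σ (fvTs ts) z
    fvTs-substTs⁻ σ []       ()
    fvTs-substTs⁻ σ (t ∷ ts) =
      occursVia-++ σ (fvT (substT σ t)) (fvT-substT⁻ σ t) (fvTs-substTs⁻ σ ts)

  fvF-substF⁻ : ∀ {n z} σ (F : Formula n) → z ∈ fvF (substF σ F) → OccursVia σ (fvF F) z
  fvF-substF⁻ σ (ind P ts) = fvTs-substTs⁻ σ ts
  fvF-substF⁻ σ (ord Q ts) = fvTs-substTs⁻ σ ts
  fvF-substF⁻ σ (eq t u)   =
    occursVia-++ σ (fvT (substT σ t)) (fvT-substT⁻ σ t) (fvT-substT⁻ σ u)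
  fvF-substF⁻ σ (neg F)    = fvF-substF⁻ σ F
  fvF-substF⁻ σ (or F G)   =
    occursVia-++ σ (fvF (substF σ F)) (fvF-substF⁻ σ F) (fvF-substF⁻ σ G)
  fvF-substF⁻ σ (and F G)  =
    occursVia-++ σ (fvF (substF σ F)) (fvF-substF⁻ σ F) (fvF-substF⁻ σ G)
  fvF-substF⁻ σ (imp F G)  =
    occursVia-++ σ (fvF (substF σ F)) (fvF-substF⁻ σ F) (fvF-substF⁻ σ G)
  fvF-substF⁻ σ (ex F)     = fvF-substF⁻ σ F
  fvF-substF⁻ σ (all F)    = fvF-substF⁻ σ F

module Replacement (sig : Signature) where
  open CLKID sig
  open Substitution sig

  infix 5 _↦_
  _↦_ : ℕ → Term 0 → Subst
  v ↦ s = [ s / v , var v / v ]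

  ↦-self : ∀ v s → (v ↦ s) v ≡ s
  ↦-self v s with v ≟ v
  ... | yes _  = refl
  ... | no v≢v = ⊥-elim (v≢v refl)

  ↦-other : ∀ {v y} s → y ≢ v → (v ↦ s) y ≡ var y
  ↦-other {v} {y} s y≢v with y ≟ v
  ... | yes y≡v = ⊥-elim (y≢v y≡v)
  ... | no _ with y ≟ v
  ...   | yes y≡v = ⊥-elim (y≢v y≡v)
  ...   | no _    = refl

  -- the premise substitution of (=L) with x = y = v: since the first clause of [_/_,_/_] wins,
  -- it is the identity
  restore-var : ∀ v s y → [ var v / v , s / v ] y ≡ var y
  restore-var v s y with y ≟ v
  ... | yes refl = refl
  ... | no y≢v with y ≟ v
  ...   | yes y≡v = ⊥-elim (y≢v y≡v)
  ...   | no _    = refl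

  substF-restore : ∀ v s (F : Formula 0) → substF [ var v / v , s / v ] F ≡ F
  substF-restore v s F = trans (substF-cong F λ y _ → restore-var v s y) (substF-id F)

  substL-restore : ∀ v s (L : List (Formula 0)) → substL [ var v / v , s / v ] L ≡ L
  substL-restore v s L =
    trans (map-cong-local (All.tabulate λ {F} _ → substF-restore v s F)) (map-id L)

  substT-↦-fresh : ∀ {v} s (t : Term 0) → v ∉ fvT t → substT (v ↦ s) t ≡ t
  substT-↦-fresh s t v∉t =
    trans (substT-cong t λ y y∈t → ↦-other s λ { refl → v∉t y∈t }) (substT-id t)

  ∉-fvF-↦ : ∀ {n v s} (F : Formula n) → v ∉ fvT s → v ∉ fvF (substF (v ↦ s) F)
  ∉-fvF-↦ {v = v} {s} F v∉s v∈ = occurs (fvF-substF⁻ (v ↦ s) F v∈)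
    where
      occurs : ∀ {xs} → OccursVia (v ↦ s) xs v → ⊥
      occurs (there o) = occurs o
      occurs (here {y} v∈σy) = ruledOut (y ≟ v) v∈σy
        where
          ruledOut : Dec (y ≡ v) → v ∉ fvT ((v ↦ s) y)
          ruledOut (yes refl) v∈ = v∉s (≡-subst (λ t → v ∈ fvT t) (↦-self v s) v∈)
          ruledOut (no y≢v)   v∈ with ≡-subst (λ t → v ∈ fvT t) (↦-other s y≢v) v∈
          ... | here v≡y = y≢v (sym v≡y)

  ∉-fvList-↦ : ∀ {v s} (L : List (Formula 0)) → v ∉ fvT s → v ∉ fvList (substL (v ↦ s) L)
  ∉-fvList-↦ []      v∉s ()
  ∉-fvList-↦ {v} {s} (F ∷ L) v∉s v∈ with ∈-++⁻ (fvF (substF (v ↦ s) F)) v∈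
  ... | inj₁ v∈F = ∉-fvF-↦ F v∉s v∈F
  ... | inj₂ v∈L = ∉-fvList-↦ L v∉s v∈L

  Replacement : Set
  Replacement = ℕ × Term 0

  Admissible : Replacement → Set
  Admissible (v , s) = v ∉ fvT s

  -- the head of the list is applied last
  replaceT : List Replacement → Term 0 → Term 0
  replaceT []             t = t
  replaceT ((v , s) ∷ rs) t = substT (v ↦ s) (replaceT rs t)

  replaceF : List Replacement → Formula 0 → Formula 0
  replaceF []             F = F
  replaceF ((v , s) ∷ rs) F = substF (v ↦ s) (replaceF rs F)

  replaceL : List Replacement → List (Formula 0) → List (Formula 0)
  replaceL []             L = L
  replaceL ((v , s) ∷ rs) L = substL (v ↦ s) (replaceL rs L)

  ⟦_⟧ : List Replacement → Subst
  ⟦ rs ⟧ x = replaceT rs (var x)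

  replaceF≡substF : ∀ rs F → replaceF rs F ≡ substF ⟦ rs ⟧ F
  replaceF≡substF []             F = sym (substF-id F)
  replaceF≡substF ((v , s) ∷ rs) F =
    trans (cong (substF (v ↦ s)) (replaceF≡substF rs F)) (substF-⊙ (v ↦ s) ⟦ rs ⟧ F)

  replaceL≡map : ∀ rs L → replaceL rs L ≡ map (replaceF rs) L
  replaceL≡map []             L = sym (map-id L)
  replaceL≡map ((v , s) ∷ rs) L =
    trans (cong (substL (v ↦ s)) (replaceL≡map rs L)) (sym (map-∘ L))

  ∈-replaceL : ∀ rs {F L} → F ∈ L → replaceF rs F ∈ replaceL rs L
  ∈-replaceL []             F∈L = F∈L
  ∈-replaceL ((v , s) ∷ rs) F∈L = ∈-map⁺ (substF (v ↦ s)) (∈-replaceL rs F∈L)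

  replaceT-++ : ∀ rs rs′ t → replaceT (rs ++ rs′) t ≡ replaceT rs (replaceT rs′ t)
  replaceT-++ []             rs′ t = refl
  replaceT-++ ((v , s) ∷ rs) rs′ t = cong (substT (v ↦ s)) (replaceT-++ rs rs′ t)

  ⟦∷⟧-var : ∀ {v s} rs {x y} → ⟦ rs ⟧ x ≡ var y → ⟦ (v , s) ∷ rs ⟧ x ≡ (v ↦ s) y
  ⟦∷⟧-var {v} {s} rs {y = y} rs[x]≡y =
    trans (cong (substT (v ↦ s)) rs[x]≡y) (substT-var (v ↦ s) y)

  -- First rename every x < M to the fresh N + x, then replace N + x by θ x.
  module Factorisation (θ : Subst) (m : ℕ) where
    M : ℕ
    M = suc m

    N : ℕ
    N = M + suc (max 0 (concatMap (fvT ∘ θ) (upTo M)))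

    θ-bounded : ∀ {x y} → x < M → y ∈ fvT (θ x) → y < N
    θ-bounded {x} x<M y∈θx = ≤-trans (s≤s (All.lookup (xs≤max 0 _) y∈)) (m≤n+m _ M)
      where y∈ = ∈-concatMap⁺ (fvT ∘ θ) (Any.map (λ { refl → y∈θx }) (∈-upTo⁺ x<M))

    M≤N : M ≤ N
    M≤N = m≤m+n M _

    freshening : ℕ → List Replacement
    freshening zero    = []
    freshening (suc k) = (k , var (N + k)) ∷ freshening k

    instantiation : ℕ → List Replacement
    instantiation zero    = []
    instantiation (suc k) = (N + k , θ k) ∷ instantiation k

    freshening-above : ∀ k x → k ≤ x → ⟦ freshening k ⟧ x ≡ var x
    freshening-above zero    x _   = refl
    freshening-above (suc k) x k<x =
      trans (⟦∷⟧-var (freshening k) (freshening-above k x (<⇒≤ k<x))) (↦-other _ (>⇒≢ k<x))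

    freshening-below : ∀ k x → k ≤ N → x < k → ⟦ freshening k ⟧ x ≡ var (N + x)
    freshening-below (suc k) x k<N x<1+k with m<1+n⇒m<n∨m≡n x<1+k
    ... | inj₁ x<k = trans (⟦∷⟧-var (freshening k) (freshening-below k x (<⇒≤ k<N) x<k))
                           (↦-other _ (>⇒≢ (<-≤-trans k<N (m≤m+n N x))))
    ... | inj₂ refl = trans (⟦∷⟧-var (freshening x) (freshening-above x x ≤-refl)) (↦-self x _)

    instantiation-above : ∀ k y → N + k ≤ y → ⟦ instantiation k ⟧ y ≡ var y
    instantiation-above zero    y _ = refl
    instantiation-above (suc k) y N+k<y =
      trans (⟦∷⟧-var (instantiation k)
                     (instantiation-above k y (≤-trans (+-monoʳ-≤ N (n≤1+n k)) N+k<y)))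
            (↦-other _ (>⇒≢ (≤-trans (≤-reflexive (sym (+-suc N k))) N+k<y)))

    instantiation-below : ∀ k x → k ≤ M → x < k → ⟦ instantiation k ⟧ (N + x) ≡ θ x
    instantiation-below (suc k) x k<M x<1+k with m<1+n⇒m<n∨m≡n x<1+k
    ... | inj₁ x<k = trans (cong (substT (N + k ↦ θ k))
                                 (instantiation-below k x (<⇒≤ k<M) x<k))
                           (substT-↦-fresh (θ k) (θ x) λ N+k∈θx →
                              n≮n _ (≤-trans (θ-bounded (<-trans x<k k<M) N+k∈θx) (m≤m+n N k)))
    ... | inj₂ refl =
      trans (⟦∷⟧-var (instantiation x) (instantiation-above x (N + x) ≤-refl)) (↦-self (N + x) _)

    replacements : List⁺ Replacement
    replacements = (N + m , θ m) List⁺.∷ (instantiation m ++ freshening M)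

    admissible : All Admissible (toList replacements)
    admissible = All.++⁺ (instantiations M ≤-refl) (freshenings M)
      where
        0<N : 0 < N
        0<N = <-≤-trans (s≤s z≤n) (m≤n+m _ M)

        freshenings : ∀ k → All Admissible (freshening k)
        freshenings zero    = []
        freshenings (suc k) = (λ { (here k≡N+k) → <⇒≢ (m<n+m k 0<N) k≡N+k }) ∷ freshenings k

        instantiations : ∀ k → k ≤ M → All Admissible (instantiation k)
        instantiations zero    _   = []
        instantiations (suc k) k<M =
          (λ N+k∈θk → n≮n _ (≤-trans (θ-bounded k<M N+k∈θk) (m≤m+n N k)))
          ∷ instantiations k (<⇒≤ k<M)

    replacements-agree : ∀ x → x < M → ⟦ toList replacements ⟧ x ≡ θ x
    replacements-agree x x<M = begin
      replaceT (instantiation M ++ freshening M) (var x) ≡⟨ replaceT-++ (instantiation M) _ (var x) ⟩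
      replaceT (instantiation M) (⟦ freshening M ⟧ x)    ≡⟨ cong (replaceT (instantiation M))
                                                                 (freshening-below M x M≤N x<M) ⟩
      ⟦ instantiation M ⟧ (N + x)                        ≡⟨ instantiation-below M x ≤-refl x<M ⟩
      θ x                                                ∎
      where open ≡-Reasoning

  -- Nonempty, so that a simulated (Subst) step occupies at least one node of the new tree.
  opaque
    factorise : ∀ (θ : Subst) m → Σ[ rs ∈ List⁺ Replacement ]
                All Admissible (toList rs) × (∀ x → x ≤ m → ⟦ toList rs ⟧ x ≡ θ x)
    factorise θ m = replacements , admissible , λ x → replacements-agree x ∘ s≤s
      where open Factorisation θ m

  replaceF-agree : ∀ rs θ F → Agree ⟦ rs ⟧ θ (fvF F) → replaceF rs F ≡ substF θ F
  replaceF-agree rs θ F agree = trans (replaceF≡substF rs F) (substF-cong F agree)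

  fvF⊆fvList : ∀ {F L x} → F ∈ L → x ∈ fvF F → x ∈ fvList L
  fvF⊆fvList F∈L x∈F = ∈-concat⁺′ x∈F (∈-map⁺ fvF F∈L)

  replaceL-agree : ∀ rs θ L → Agree ⟦ rs ⟧ θ (fvList L) → replaceL rs L ≡ substL θ L
  replaceL-agree rs θ L agree =
    trans (replaceL≡map rs L) (map-cong-local (All.tabulate λ {F} F∈L →
      replaceF-agree rs θ F λ x x∈F → agree x (fvF⊆fvList F∈L x∈F)))

  replacementsFor : Seq → Subst → List Replacement
  replacementsFor S θ = toList (proj₁ (factorise θ (max 0 (fvSeq S))))

  replacementsFor-admissible : ∀ S θ → All Admissible (replacementsFor S θ)
  replacementsFor-admissible S θ = proj₁ (proj₂ (factorise θ (max 0 (fvSeq S))))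

  replacementsFor-agree : ∀ S θ → Agree ⟦ replacementsFor S θ ⟧ θ (fvSeq S)
  replacementsFor-agree S θ x x∈S =
    proj₂ (proj₂ (factorise θ (max 0 (fvSeq S)))) x (All.lookup (xs≤max 0 (fvSeq S)) x∈S)

  replacementsFor-soundF : ∀ Γ Δ θ {F} → F ∈ Γ →
                           replaceF (replacementsFor (Γ ⊢ Δ) θ) F ≡ substF θ F
  replacementsFor-soundF Γ Δ θ {F} F∈Γ = replaceF-agree (replacementsFor (Γ ⊢ Δ) θ) θ F λ x x∈F →
    replacementsFor-agree (Γ ⊢ Δ) θ x (∈-++⁺ˡ (fvF⊆fvList F∈Γ x∈F))

  replacementsFor-sound : ∀ Γ Δ θ → let rs = replacementsFor (Γ ⊢ Δ) θ in
                          replaceL rs Γ ≡ substL θ Γ × replaceL rs Δ ≡ substL θ Δ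
  replacementsFor-sound Γ Δ θ =
    replaceL-agree rs θ Γ (λ x x∈Γ → agree x (∈-++⁺ˡ x∈Γ)) ,
    replaceL-agree rs θ Δ (λ x x∈Δ → agree x (∈-++⁺ʳ (fvList Γ) x∈Δ))
    where
      rs    = replacementsFor (Γ ⊢ Δ) θ
      agree = replacementsFor-agree (Γ ⊢ Δ) θ

module Segments (start : ℕ) (len : ℕ → ℕ) (len>0 : ∀ n → 0 < len n) where

  offset : ℕ → ℕ
  offset zero    = start
  offset (suc n) = offset n + len n

  offset-< : ∀ n → offset n < offset (suc n)
  offset-< n = ≤-trans (≤-reflexive (+-comm 1 (offset n))) (+-monoʳ-≤ (offset n) (len>0 n))

  offset-mono-≤ : ∀ {m n} → m ≤ n → offset m ≤ offset n
  offset-mono-≤ {m} {zero}  z≤n = ≤-refl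
  offset-mono-≤ {m} {suc n} m≤1+n with m≤n⇒m<n∨m≡n m≤1+n
  ... | inj₁ m<1+n = ≤-trans (offset-mono-≤ (s≤s⁻¹ m<1+n)) (<⇒≤ (offset-< n))
  ... | inj₂ refl  = ≤-refl

  start≤offset : ∀ n → start ≤ offset n
  start≤offset n = offset-mono-≤ {0} {n} z≤n

  n≤offset : ∀ n → n ≤ offset n
  n≤offset zero    = z≤n
  n≤offset (suc n) = ≤-trans (s≤s (n≤offset n)) (offset-< n)

  inside-< : ∀ {m n o} → o < len m → m < n → offset m + o < offset n
  inside-< {m} o<len m<n = <-≤-trans (+-monoʳ-< (offset m) o<len) (offset-mono-≤ m<n)

  inside-unique : ∀ {m n o o′} → o < len m → o′ < len n →
                  offset m + o ≡ offset n + o′ → m ≡ n × o ≡ o′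
  inside-unique {m} {n} {o} {o′} o<len o′<len eq with <-cmp m n
  ... | tri< m<n _ _ =
    ⊥-elim (<-irrefl eq (<-≤-trans (inside-< o<len m<n) (m≤m+n (offset n) o′)))
  ... | tri> _ _ n<m =
    ⊥-elim (<-irrefl (sym eq) (<-≤-trans (inside-< o′<len n<m) (m≤m+n (offset m) o)))
  ... | tri≈ _ refl _ = refl , +-cancelˡ-≡ (offset m) o o′ eq

  walk : ℕ → ℕ × ℕ
  walk zero = 0 , 0
  walk (suc r) with walk r
  ... | n , o with suc o <? len n
  ...   | yes _ = n , suc o
  ...   | no _  = suc n , 0

  walk-sound : ∀ r → let (n , o) = walk r in offset n + o ≡ start + r × o < len n
  walk-sound zero = refl , len>0 0
  walk-sound (suc r) with walk r | walk-sound r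
  ... | n , o | eq , o<len with suc o <? len n
  ...   | yes 1+o<len =
    trans (+-suc (offset n) o) (trans (cong suc eq) (sym (+-suc start r))) , 1+o<len
  ...   | no  1+o≮len = (begin
            offset n + len n + 0   ≡⟨ +-identityʳ _ ⟩
            offset n + len n       ≡⟨ cong (offset n +_) 1+o≡len ⟨
            offset n + suc o       ≡⟨ +-suc (offset n) o ⟩
            suc (offset n + o)     ≡⟨ cong suc eq ⟩
            suc (start + r)        ≡⟨ +-suc start r ⟨
            start + suc r          ∎)
          , len>0 (suc n)
    where
      open ≡-Reasoning
      1+o≡len : suc o ≡ len n
      1+o≡len with m≤n⇒m<n∨m≡n o<len
      ... | inj₁ 1+o<len = ⊥-elim (1+o≮len 1+o<len)
      ... | inj₂ 1+o≡len = 1+o≡len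

  locate : ℕ → ℕ × ℕ
  locate x = walk (x ∸ start)

  locate-sound : ∀ {x} → start ≤ x → let (n , o) = locate x in offset n + o ≡ x × o < len n
  locate-sound {x} start≤x =
    trans (proj₁ (walk-sound (x ∸ start))) (m+[n∸m]≡n start≤x) , proj₂ (walk-sound (x ∸ start))

  locate-inside : ∀ {n o} → o < len n → locate (offset n + o) ≡ (n , o)
  locate-inside {n} {o} o<len = cong₂ _,_ (proj₁ same) (proj₂ same)
    where
      sound = locate-sound (≤-trans (start≤offset n) (m≤m+n (offset n) o))
      same = inside-unique (proj₂ sound) o<len (proj₁ sound)

  locate-≥ : ∀ {k x} → offset k ≤ x → k ≤ proj₁ (locate x)
  locate-≥ {k} {x} offset≤x with k ≤? proj₁ (locate x)
  ... | yes k≤n = k≤n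
  ... | no  k≰n = ⊥-elim (<-irrefl (proj₁ sound)
                    (<-≤-trans (inside-< (proj₂ sound) (≰⇒> k≰n)) offset≤x))
    where sound = locate-sound (≤-trans (start≤offset k) offset≤x)

module Elimination (sig : Signature) (Φ : CLKID.InductiveDefs sig) where
  open CLKID sig
  open Rules Φ
  open Substitution sig
  open Replacement sig

  ≈S-refl : ∀ {S} → S ≈S S
  ≈S-refl = (⊆-refl , ⊆-refl) , (⊆-refl , ⊆-refl)

  ≈S-sym : ∀ {S S′} → S ≈S S′ → S′ ≈S S
  ≈S-sym ((Γ⊆ , ⊇Γ) , (Δ⊆ , ⊇Δ)) = (⊇Γ , Γ⊆) , (⊇Δ , Δ⊆)

  ≈S-trans : ∀ {S S′ S″} → S ≈S S′ → S′ ≈S S″ → S ≈S S″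
  ≈S-trans ((Γ⊆ , ⊇Γ) , (Δ⊆ , ⊇Δ)) ((Γ⊆′ , ⊇Γ′) , (Δ⊆′ , ⊇Δ′)) =
    (⊆-trans Γ⊆ Γ⊆′ , ⊆-trans ⊇Γ′ ⊇Γ) , (⊆-trans Δ⊆ Δ⊆′ , ⊆-trans ⊇Δ′ ⊇Δ)

  ≡⇒≈S : ∀ {S S′} → S ≡ S′ → S ≈S S′
  ≡⇒≈S refl = ≈S-refl

  data SubstView : ∀ {S ps} → Inst S ps → Set where
    isSubst  : ∀ Γ Δ θ → SubstView (subst Γ Δ θ)
    notSubst : ∀ {S ps} (r : Inst S ps) → NoSubstInst r → SubstView r

  substView : ∀ {S ps} (r : Inst S ps) → SubstView r
  substView (subst Γ Δ θ)             = isSubst Γ Δ θ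
  substView r@(axiom _ _ _)           = notSubst r tt
  substView r@(wk _ _)                = notSubst r tt
  substView r@(cut _ _ _)             = notSubst r tt
  substView r@(negL _ _ _)            = notSubst r tt
  substView r@(negR _ _ _)            = notSubst r tt
  substView r@(orL _ _ _ _)           = notSubst r tt
  substView r@(orR _ _ _ _)           = notSubst r tt
  substView r@(andL _ _ _ _)          = notSubst r tt
  substView r@(andR _ _ _ _)          = notSubst r tt
  substView r@(impL _ _ _ _)          = notSubst r tt
  substView r@(impR _ _ _ _)          = notSubst r tt
  substView r@(allL _ _ _ _)          = notSubst r tt
  substView r@(allR _ _ _ _ _)        = notSubst r tt
  substView r@(exL _ _ _ _ _)         = notSubst r tt
  substView r@(exR _ _ _ _)           = notSubst r tt
  substView r@(eqL _ _ _ _ _ _)       = notSubst r tt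
  substView r@(eqR _ _ _)             = notSubst r tt
  substView r@(unfoldL _ _ _ _ _ _)   = notSubst r tt
  substView r@(unfoldR _ _ _ _ _ _)   = notSubst r tt

  eqTo : Term 0 → Formula 1
  eqTo s = eq (wk0 s) (bvar Fin.zero)

  instF-eqTo : ∀ u s → instF u (eqTo s) ≡ eq s u
  instF-eqTo u s = cong₂ eq (trans (instT-wk0 u s) (wk0-id s)) (wk0-id u)

  ∉-fvSeq-↦ : ∀ {v s} A B → v ∉ fvT s →
              v ∉ fvSeq ((ex (eqTo s) ∷ substL (v ↦ s) A) ⊢ substL (v ↦ s) B)
  ∉-fvSeq-↦ {v} {s} A B v∉s v∈ with ∈-++⁻ (fvList (ex (eqTo s) ∷ substL (v ↦ s) A)) v∈
  ... | inj₂ v∈B = ∉-fvList-↦ B v∉s v∈B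
  ... | inj₁ v∈ with ∈-++⁻ (fvF (ex (eqTo s))) v∈
  ...   | inj₂ v∈A = ∉-fvList-↦ A v∉s v∈A
  ...   | inj₁ v∈ with ∈-++⁻ (fvT (wk0 {1} s)) v∈
  ...     | inj₁ v∈s = v∉s (≡-subst (v ∈_) (fvT-wk0 s) v∈s)
  ...     | inj₂ ()

  ∃-refl-tree : (A B : List (Formula 0)) (s : Term 0) → Tree
  ∃-refl-tree A B s =
    node (A ⊢ (ex (eqTo s) ∷ B)) (exR A B (eqTo s) s)
      (node (A ⊢ (eq s s ∷ B)) (eqR A B s) [] ∷ [])

  mutual
    simulate : (rs : List Replacement) → All Admissible rs → (Γ Δ : List (Formula 0)) → Tree → Tree
    simulate []             _    Γ Δ c = c
    simulate ((v , s) ∷ rs) adms Γ Δ c =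
      node (substL (v ↦ s) (replaceL rs Γ) ⊢ substL (v ↦ s) (replaceL rs Δ))
        (cut (substL (v ↦ s) (replaceL rs Γ)) (substL (v ↦ s) (replaceL rs Δ)) (ex (eqTo s)))
        (∃-refl-tree (substL (v ↦ s) (replaceL rs Γ)) (substL (v ↦ s) (replaceL rs Δ)) s
         ∷ simulate-∃L v s (All.head adms) rs (All.tail adms) Γ Δ c ∷ [])

    simulate-∃L : ∀ v s → Admissible (v , s) → (rs : List Replacement) → All Admissible rs →
                  (Γ Δ : List (Formula 0)) → Tree → Tree
    simulate-∃L v s adm rs adms Γ Δ c =
      node ((ex (eqTo s) ∷ substL (v ↦ s) (replaceL rs Γ)) ⊢ substL (v ↦ s) (replaceL rs Δ))
        (exL (substL (v ↦ s) (replaceL rs Γ)) (substL (v ↦ s) (replaceL rs Δ)) (eqTo s) v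
             (∉-fvSeq-↦ (replaceL rs Γ) (replaceL rs Δ) adm))
        (simulate-=L v s rs adms Γ Δ c ∷ [])

    simulate-=L : ∀ v s → (rs : List Replacement) → All Admissible rs →
                  (Γ Δ : List (Formula 0)) → Tree → Tree
    simulate-=L v s rs adms Γ Δ c =
      node ((eq s (var v) ∷ substL (v ↦ s) (replaceL rs Γ)) ⊢ substL (v ↦ s) (replaceL rs Δ))
        (eqL (replaceL rs Γ) (replaceL rs Δ) v v s (var v))
        (simulate rs adms Γ Δ c ∷ [])

  simulate-WF : ∀ rs adms Γ Δ c → WF c → concl c ≈S (Γ ⊢ Δ) →
                WF (simulate rs adms Γ Δ c) ×
                concl (simulate rs adms Γ Δ c) ≈S (replaceL rs Γ ⊢ replaceL rs Δ)
  simulate-WF []             _    Γ Δ c wf-c c≈ = wf-c , c≈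
  simulate-WF ((v , s) ∷ rs) adms Γ Δ c wf-c c≈ =
    (≈S-refl , ≈S-refl ∷ ≈S-refl ∷ [] , wf-∃R , wf-∃L , tt) , ≈S-refl
    where
      Γ′ = substL (v ↦ s) (replaceL rs Γ)
      Δ′ = substL (v ↦ s) (replaceL rs Δ)
      ih = simulate-WF rs (All.tail adms) Γ Δ c wf-c c≈

      wf-∃R : WF (∃-refl-tree Γ′ Δ′ s)
      wf-∃R = ≈S-refl , ≡⇒≈S (cong (λ F → Γ′ ⊢ (F ∷ Δ′)) (sym (instF-eqTo s s))) ∷ []
            , (≈S-refl , [] , tt) , tt

      wf-=L : WF (simulate-=L v s rs (All.tail adms) Γ Δ c)
      wf-=L = ≈S-refl
            , ≈S-trans (proj₂ ih) (≡⇒≈S (sym (cong₂ _⊢_ (substL-restore v s (replaceL rs Γ))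
                                                          (substL-restore v s (replaceL rs Δ))))) ∷ []
            , proj₁ ih , tt

      wf-∃L : WF (simulate-∃L v s (All.head adms) rs (All.tail adms) Γ Δ c)
      wf-∃L = ≈S-refl
            , ≡⇒≈S (cong (λ F → (F ∷ Γ′) ⊢ Δ′) (sym (instF-eqTo (var v) s))) ∷ []
            , wf-=L , tt

  simulate-SubstFree : ∀ rs adms Γ Δ c → SubstFree c → SubstFree (simulate rs adms Γ Δ c)
  simulate-SubstFree []             _    Γ Δ c sf = sf
  simulate-SubstFree ((v , s) ∷ rs) adms Γ Δ c sf =
    tt , (tt , (tt , tt) , tt) ,
    (tt , (tt , simulate-SubstFree rs (All.tail adms) Γ Δ c sf , tt) , tt) , tt

  reps : List (Formula 0) → List (Formula 0) → Subst → List Replacement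
  reps Γ Δ θ = replacementsFor (Γ ⊢ Δ) θ

  adms : ∀ Γ Δ θ → All Admissible (reps Γ Δ θ)
  adms Γ Δ θ = replacementsFor-admissible (Γ ⊢ Δ) θ

  simulateSubst : (Γ Δ : List (Formula 0)) → Subst → Tree → Tree
  simulateSubst Γ Δ θ = simulate (reps Γ Δ θ) (adms Γ Δ θ) Γ Δ

  -- the clause for a (Subst) node without exactly one child is junk: such trees are not WF
  removeSubstNode : ∀ {S′ ps} (S : Seq) (r : Inst S′ ps) → SubstView r → List Tree → Tree
  removeSubstNode S r (isSubst Γ Δ θ) (c ∷ []) = simulateSubst Γ Δ θ c
  removeSubstNode S r (isSubst Γ Δ θ) _        = bud S
  removeSubstNode S r (notSubst r _)  cs       = node S r cs

  mutual
    removeSubst : Tree → Tree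
    removeSubst (bud S)       = bud S
    removeSubst (node S r cs) = removeSubstNode S r (substView r) (removeSubstL cs)

    removeSubstL : List Tree → List Tree
    removeSubstL []       = []
    removeSubstL (c ∷ cs) = removeSubst c ∷ removeSubstL cs

  mutual
    removeSubst-SubstFree : ∀ T → SubstFree (removeSubst T)
    removeSubst-SubstFree (bud S) = tt
    removeSubst-SubstFree (node S r cs) with substView r
    ... | notSubst r r≢subst = r≢subst , removeSubstL-SubstFree cs
    ... | isSubst Γ Δ θ      = subst-case cs
      where
        subst-case : ∀ cs →
                     SubstFree (removeSubstNode S (subst Γ Δ θ) (isSubst Γ Δ θ) (removeSubstL cs))
        subst-case []           = tt
        subst-case (c ∷ [])     =
          simulate-SubstFree (reps Γ Δ θ) (adms Γ Δ θ) Γ Δ (removeSubst c) (removeSubst-SubstFree c)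
        subst-case (_ ∷ _ ∷ _)  = tt

    removeSubstL-SubstFree : ∀ cs → SubstFreeL (removeSubstL cs)
    removeSubstL-SubstFree []       = tt
    removeSubstL-SubstFree (c ∷ cs) = removeSubst-SubstFree c , removeSubstL-SubstFree cs

  Premises : List Tree → List Seq → Set
  Premises = Pointwise (λ c p → concl c ≈S p)

  mutual
    removeSubst-WF : ∀ T → WF T → WF (removeSubst T) × concl (removeSubst T) ≈S concl T
    removeSubst-WF (bud S) _ = tt , ≈S-refl
    removeSubst-WF (node S r cs) (S≈ , prem , wf-cs) with substView r
    ... | notSubst r _ = (S≈ , removeSubstL-WF cs prem wf-cs) , ≈S-refl
    ... | isSubst Γ Δ θ with cs | prem | wf-cs
    ...   | c ∷ [] | c≈ ∷ [] | wf-c , _ =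
      proj₁ sim , ≈S-trans (proj₂ sim) (≈S-trans (≡⇒≈S (cong₂ _⊢_ Γ-sound Δ-sound)) (≈S-sym S≈))
      where
        ih  = removeSubst-WF c wf-c
        sim = simulate-WF (reps Γ Δ θ) (adms Γ Δ θ) Γ Δ (removeSubst c) (proj₁ ih)
                          (≈S-trans (proj₂ ih) c≈)
        Γ-sound = proj₁ (replacementsFor-sound Γ Δ θ)
        Δ-sound = proj₂ (replacementsFor-sound Γ Δ θ)

    removeSubstL-WF : ∀ {ps} cs → Premises cs ps → WFs cs →
                      Premises (removeSubstL cs) ps × WFs (removeSubstL cs)
    removeSubstL-WF []       []           _             = [] , tt
    removeSubstL-WF (c ∷ cs) (c≈ ∷ cs≈) (wf-c , wf-cs) =
      ≈S-trans (proj₂ ih) c≈ ∷ proj₁ ihs , proj₁ ih , proj₂ ihs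
      where
        ih  = removeSubst-WF c wf-c
        ihs = removeSubstL-WF cs cs≈ wf-cs

module Positions (sig : Signature) (Φ : CLKID.InductiveDefs sig) where
  open CLKID sig
  open Rules Φ
  open Replacement sig
  open Elimination sig Φ

  -- The spine of simulate rs runs through the (Cut), (∃L) and (=L) nodes of each replacement in
  -- turn: depth d on it is reached by spinePath rs d, and left towards depth d + 1 by child spineDir d.
  spineLength : List Replacement → ℕ
  spineLength []       = 0
  spineLength (_ ∷ rs) = 3 + spineLength rs

  exitPath : List Replacement → List ℕ
  exitPath []       = []
  exitPath (_ ∷ rs) = 1 ∷ 0 ∷ 0 ∷ exitPath rs

  spinePath : List Replacement → ℕ → List ℕ
  spinePath []       _                   = []
  spinePath (_ ∷ rs) 0                   = []
  spinePath (_ ∷ rs) 1                   = 1 ∷ []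
  spinePath (_ ∷ rs) 2                   = 1 ∷ 0 ∷ []
  spinePath (_ ∷ rs) (suc (suc (suc d))) = 1 ∷ 0 ∷ 0 ∷ spinePath rs d

  spineDir : ℕ → ℕ
  spineDir 0                   = 1
  spineDir 1                   = 0
  spineDir 2                   = 0
  spineDir (suc (suc (suc d))) = spineDir d

  spinePath-0 : ∀ rs → spinePath rs 0 ≡ []
  spinePath-0 []      = refl
  spinePath-0 (_ ∷ _) = refl

  spinePath-end : ∀ rs → spinePath rs (spineLength rs) ≡ exitPath rs
  spinePath-end []       = refl
  spinePath-end (_ ∷ rs) = cong (λ q → 1 ∷ 0 ∷ 0 ∷ q) (spinePath-end rs)

  spinePath-suc : ∀ rs d → d < spineLength rs →
                  spinePath rs (suc d) ≡ spinePath rs d ++ [ spineDir d ]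
  spinePath-suc (_ ∷ rs) 0 _ = refl
  spinePath-suc (_ ∷ rs) 1 _ = refl
  spinePath-suc (_ ∷ rs) 2 _ = cong (λ q → 1 ∷ 0 ∷ 0 ∷ q) (spinePath-0 rs)
  spinePath-suc (_ ∷ rs) (suc (suc (suc d))) (s≤s (s≤s (s≤s d<))) =
    cong (λ q → 1 ∷ 0 ∷ 0 ∷ q) (spinePath-suc rs d d<)

  simulateAt : (rs : List Replacement) → All Admissible rs → (Γ Δ : List (Formula 0)) → Tree →
               ℕ → Tree
  simulateAt []             _  Γ Δ c _ = c
  simulateAt ((v , s) ∷ rs) as Γ Δ c 0 = simulate ((v , s) ∷ rs) as Γ Δ c
  simulateAt ((v , s) ∷ rs) as Γ Δ c 1 = simulate-∃L v s (All.head as) rs (All.tail as) Γ Δ c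
  simulateAt ((v , s) ∷ rs) as Γ Δ c 2 = simulate-=L v s rs (All.tail as) Γ Δ c
  simulateAt ((v , s) ∷ rs) as Γ Δ c (suc (suc (suc d))) = simulateAt rs (All.tail as) Γ Δ c d

  -- subtrees that no infinite path can enter
  data Dead : Tree → Set where
    ∃-refl-dead : ∀ A B s → Dead (∃-refl-tree A B s)
    leaf-dead   : ∀ S {S′ ps} (r : Inst S′ ps) → Dead (node S r [])

  module _ (Γ Δ : List (Formula 0)) (c : Tree) where

    at-spinePath : ∀ rs as d →
                   at (simulate rs as Γ Δ c) (spinePath rs d) ≡ just (simulateAt rs as Γ Δ c d)
    at-spinePath []       _  _                   = refl
    at-spinePath (_ ∷ rs) as 0                   = refl
    at-spinePath (_ ∷ rs) as 1                   = refl
    at-spinePath (_ ∷ rs) as 2                   = refl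
    at-spinePath (_ ∷ rs) as (suc (suc (suc d))) = at-spinePath rs (All.tail as) d

    at-exitPath : ∀ rs as q → at (simulate rs as Γ Δ c) (exitPath rs ++ q) ≡ at c q
    at-exitPath []       _  q = refl
    at-exitPath (_ ∷ rs) as q = at-exitPath rs (All.tail as) q

    simulateAt-IsNode : ∀ rs as d → d < spineLength rs → IsNode (simulateAt rs as Γ Δ c d)
    simulateAt-IsNode (_ ∷ rs) as 0 _ = tt
    simulateAt-IsNode (_ ∷ rs) as 1 _ = tt
    simulateAt-IsNode (_ ∷ rs) as 2 _ = tt
    simulateAt-IsNode (_ ∷ rs) as (suc (suc (suc d))) (s≤s (s≤s (s≤s d<))) =
      simulateAt-IsNode rs (All.tail as) d d<

    spine-edge : ∀ rs as d comp p q → d < spineLength rs →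
                 EdgeAt (just (simulateAt rs as Γ Δ c d)) comp p q →
                 q ≡ p ++ [ spineDir d ] ⊎
                 Σ[ X ∈ Tree ] q ≡ p ++ [ 0 ] × at (simulateAt rs as Γ Δ c d) [ 0 ] ≡ just X × Dead X
    spine-edge ((_ , s) ∷ rs) as 0 comp p q _ (0 , _ , q≡) = inj₂ (_ , q≡ , refl , ∃-refl-dead _ _ s)
    spine-edge (_ ∷ rs)       as 0 comp p q _ (1 , _ , q≡) = inj₁ q≡
    spine-edge (_ ∷ rs)       as 0 comp p q _ (suc (suc _) , s≤s (s≤s ()) , _)
    spine-edge (_ ∷ rs)       as 1 comp p q _ (0 , _ , q≡) = inj₁ q≡
    spine-edge (_ ∷ rs)       as 1 comp p q _ (suc _ , s≤s () , _)
    spine-edge (_ ∷ rs)       as 2 comp p q _ (0 , _ , q≡) = inj₁ q≡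
    spine-edge (_ ∷ rs)       as 2 comp p q _ (suc _ , s≤s () , _)
    spine-edge (_ ∷ rs)       as (suc (suc (suc d))) comp p q (s≤s (s≤s (s≤s d<))) e =
      spine-edge rs (All.tail as) d comp p q d< e

    data SpineOrigin (rs : List Replacement) (as : All Admissible rs) (q : List ℕ) (X : Tree) : Set where
      on-spine   : ∀ d → d < spineLength rs → q ≡ spinePath rs d → X ≡ simulateAt rs as Γ Δ c d →
                   SpineOrigin rs as q X
      below-exit : ∀ q′ → q ≡ exitPath rs ++ q′ → at c q′ ≡ just X → SpineOrigin rs as q X
      dead       : Dead X → SpineOrigin rs as q X

    spineOrigin : ∀ rs as q X → at (simulate rs as Γ Δ c) q ≡ just X → SpineOrigin rs as q X
    spineOrigin []             _  q                   X at≡  = below-exit q refl at≡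
    spineOrigin ((_ , s) ∷ rs) as []                  X refl = on-spine 0 (s≤s z≤n) refl refl
    spineOrigin ((_ , s) ∷ rs) as (0 ∷ [])            X refl = dead (∃-refl-dead _ _ s)
    spineOrigin ((_ , s) ∷ rs) as (0 ∷ 0 ∷ [])        X refl = dead (leaf-dead _ _)
    spineOrigin ((_ , s) ∷ rs) as (1 ∷ [])            X refl = on-spine 1 (s≤s (s≤s z≤n)) refl refl
    spineOrigin ((_ , s) ∷ rs) as (1 ∷ 0 ∷ [])        X refl = on-spine 2 (s≤s (s≤s (s≤s z≤n))) refl refl
    spineOrigin ((_ , s) ∷ rs) as (1 ∷ 0 ∷ 0 ∷ q)     X at≡
      with spineOrigin rs (All.tail as) q X at≡
    ... | on-spine d d< refl refl = on-spine (3 + d) (s≤s (s≤s (s≤s d<))) refl refl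
    ... | below-exit q′ refl at≡′ = below-exit q′ refl at≡′
    ... | dead dead-X             = dead dead-X
    spineOrigin ((_ , s) ∷ rs) as (0 ∷ 0 ∷ _ ∷ _)     X ()
    spineOrigin ((_ , s) ∷ rs) as (0 ∷ suc _ ∷ _)     X ()
    spineOrigin ((_ , s) ∷ rs) as (1 ∷ 0 ∷ suc _ ∷ _) X ()
    spineOrigin ((_ , s) ∷ rs) as (1 ∷ suc _ ∷ _)     X ()
    spineOrigin ((_ , s) ∷ rs) as (suc (suc _) ∷ _)   X ()

  mutual
    newPos : Tree → List ℕ → List ℕ
    newPos (bud S)       p       = p
    newPos (node S r cs) []      = []
    newPos (node S r cs) (j ∷ p) = newPosNode r (substView r) cs j p

    newPosNode : ∀ {S ps} (r : Inst S ps) → SubstView r → List Tree → ℕ → List ℕ → List ℕ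
    newPosNode r (isSubst Γ Δ θ) cs j p = exitPath (reps Γ Δ θ) ++ newPosL cs j p
    newPosNode r (notSubst _ _)  cs j p = j ∷ newPosL cs j p

    newPosL : List Tree → ℕ → List ℕ → List ℕ
    newPosL []       _       _ = []
    newPosL (c ∷ cs) zero    p = newPos c p
    newPosL (c ∷ cs) (suc j) p = newPosL cs j p

  mutual
    oldPos : Tree → List ℕ → List ℕ
    oldPos (bud S)       q       = q
    oldPos (node S r cs) []      = []
    oldPos (node S r cs) (j ∷ q) = oldPosNode r (substView r) cs j q

    oldPosNode : ∀ {S ps} (r : Inst S ps) → SubstView r → List Tree → ℕ → List ℕ → List ℕ
    oldPosNode r (isSubst Γ Δ θ) cs j q =
      0 ∷ oldPosL cs 0 (drop (length (exitPath (reps Γ Δ θ))) (j ∷ q))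
    oldPosNode r (notSubst _ _)  cs j q = j ∷ oldPosL cs j q

    oldPosL : List Tree → ℕ → List ℕ → List ℕ
    oldPosL []       _       _ = []
    oldPosL (c ∷ cs) zero    q = oldPos c q
    oldPosL (c ∷ cs) (suc j) q = oldPosL cs j q

  drop-++ : ∀ (xs ys : List ℕ) → drop (length xs) (xs ++ ys) ≡ ys
  drop-++ []       ys = refl
  drop-++ (x ∷ xs) ys = drop-++ xs ys

  mutual
    at-++ : ∀ T p q {t} → at T p ≡ just t → at T (p ++ q) ≡ at t q
    at-++ T             []      q refl = refl
    at-++ (bud S)       (j ∷ p) q ()
    at-++ (node S r cs) (j ∷ p) q at≡  = atL-++ cs j p q at≡

    atL-++ : ∀ cs j p q {t} → atL cs j p ≡ just t → atL cs j (p ++ q) ≡ at t q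
    atL-++ []       j       p q ()
    atL-++ (c ∷ cs) zero    p q at≡ = at-++ c p q at≡
    atL-++ (c ∷ cs) (suc j) p q at≡ = atL-++ cs j p q at≡

  mutual
    WF-at : ∀ T p {t} → WF T → at T p ≡ just t → WF t
    WF-at T             []      wf refl = wf
    WF-at (bud S)       (j ∷ p) wf ()
    WF-at (node S r cs) (j ∷ p) wf at≡  = WF-atL cs j p (proj₂ (proj₂ wf)) at≡

    WF-atL : ∀ cs j p {t} → WFs cs → atL cs j p ≡ just t → WF t
    WF-atL []       j       p wf ()
    WF-atL (c ∷ cs) zero    p (wf , _) at≡ = WF-at c p wf at≡
    WF-atL (c ∷ cs) (suc j) p (_ , wf) at≡ = WF-atL cs j p wf at≡

  atL-child : ∀ cs j {c} p → atL cs j [] ≡ just c → atL cs j p ≡ at c p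
  atL-child (c ∷ cs) zero    p refl = refl
  atL-child (c ∷ cs) (suc j) p at≡  = atL-child cs j p at≡

  newPosL-child : ∀ cs j {c} p → atL cs j [] ≡ just c → newPosL cs j p ≡ newPos c p
  newPosL-child (c ∷ cs) zero    p refl = refl
  newPosL-child (c ∷ cs) (suc j) p at≡  = newPosL-child cs j p at≡

  newPos-[] : ∀ t → newPos t [] ≡ []
  newPos-[] (bud S)       = refl
  newPos-[] (node S r cs) = refl

  newPos-rule : ∀ {S S′ ps} {r : Inst S′ ps} {cs nr} j {c} p → substView r ≡ notSubst r nr →
                atL cs j [] ≡ just c → newPos (node S r cs) (j ∷ p) ≡ j ∷ newPos c p
  newPos-rule {cs = cs} j p view≡ c≡ rewrite view≡ = cong (j ∷_) (newPosL-child cs j p c≡)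

  mutual
    newPos-sound : ∀ T p {t} → at T p ≡ just t → WF T →
                   at (removeSubst T) (newPos T p) ≡ just (removeSubst t) × oldPos T (newPos T p) ≡ p
    newPos-sound (bud S)       []      refl _ = refl , refl
    newPos-sound (node S r cs) []      refl _ = refl , refl
    newPos-sound (node S r cs) (j ∷ p) at≡  wf with substView r in view≡
    ... | notSubst r _ rewrite view≡ =
      map₂ (cong (j ∷_)) (newPosL-sound cs j p at≡ (proj₂ (proj₂ wf)))
    ... | isSubst Γ Δ θ = subst-case cs j at≡ wf
      where
        subst-case : ∀ cs j {t} → atL cs j p ≡ just t → WF (node S (subst Γ Δ θ) cs) →
                     at (removeSubstNode S (subst Γ Δ θ) (isSubst Γ Δ θ) (removeSubstL cs))
                        (exitPath (reps Γ Δ θ) ++ newPosL cs j p) ≡ just (removeSubst t) ×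
                     oldPos (node S (subst Γ Δ θ) cs) (exitPath (reps Γ Δ θ) ++ newPosL cs j p) ≡ j ∷ p
        subst-case (c ∷ []) 0 at≡ (_ , _ , wf-c , _) =
          trans (at-exitPath Γ Δ (removeSubst c) (reps Γ Δ θ) (adms Γ Δ θ) (newPos c p)) (proj₁ ih) ,
          cong (0 ∷_) (trans (cong (oldPosL (c ∷ []) 0) (drop-++ (exitPath (reps Γ Δ θ)) (newPos c p)))
                             (proj₂ ih))
          where ih = newPos-sound c p at≡ wf-c
        subst-case (c ∷ [])    (suc j) () _
        subst-case []          _       _  (_ , () , _)
        subst-case (_ ∷ _ ∷ _) _       _  (_ , _ ∷ () , _)

    newPosL-sound : ∀ cs j p {t} → atL cs j p ≡ just t → WFs cs →
                    atL (removeSubstL cs) j (newPosL cs j p) ≡ just (removeSubst t) ×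
                    oldPosL cs j (newPosL cs j p) ≡ p
    newPosL-sound []       j       p ()  _
    newPosL-sound (c ∷ cs) zero    p at≡ (wf , _) = newPos-sound c p at≡ wf
    newPosL-sound (c ∷ cs) (suc j) p at≡ (_ , wf) = newPosL-sound cs j p at≡ wf

  mutual
    newPos-++ : ∀ T p q {t} → at T p ≡ just t → newPos T (p ++ q) ≡ newPos T p ++ newPos t q
    newPos-++ (bud S)       []      q refl = refl
    newPos-++ (node S r cs) []      q refl = refl
    newPos-++ (bud S)       (j ∷ p) q ()
    newPos-++ (node S r cs) (j ∷ p) q at≡ with substView r
    ... | notSubst r _  = cong (j ∷_) (newPosL-++ cs j p q at≡)
    ... | isSubst Γ Δ θ =
      trans (cong (exitPath (reps Γ Δ θ) ++_) (newPosL-++ cs j p q at≡))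
            (sym (++-assoc (exitPath (reps Γ Δ θ)) (newPosL cs j p) _))

    newPosL-++ : ∀ cs j p q {t} → atL cs j p ≡ just t →
                 newPosL cs j (p ++ q) ≡ newPosL cs j p ++ newPos t q
    newPosL-++ []       j       p q ()
    newPosL-++ (c ∷ cs) zero    p q at≡ = newPos-++ c p q at≡
    newPosL-++ (c ∷ cs) (suc j) p q at≡ = newPosL-++ cs j p q at≡

  data NodeView : Tree → Set where
    bud-view   : ∀ S → NodeView (bud S)
    rule-view  : ∀ S {S′ ps} (r : Inst S′ ps) cs nr → substView r ≡ notSubst r nr →
                 NodeView (node S r cs)
    subst-view : ∀ S Γ Δ θ c → NodeView (node S (subst Γ Δ θ) (c ∷ []))

  nodeView : ∀ t → WF t → NodeView t
  nodeView (bud S)       _  = bud-view S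
  nodeView (node S r cs) wf with substView r in view≡
  ... | notSubst r nr = rule-view S r cs nr view≡
  ... | isSubst Γ Δ θ = subst-node cs wf
    where
      subst-node : ∀ cs → WF (node S (subst Γ Δ θ) cs) → NodeView (node S (subst Γ Δ θ) cs)
      subst-node (c ∷ [])    _            = subst-view S Γ Δ θ c
      subst-node []          (_ , () , _)
      subst-node (_ ∷ _ ∷ _) (_ , _ ∷ () , _)

  newPos-rule-child : ∀ T p {S S′ ps} {r : Inst S′ ps} {cs nr} j {c} →
                      at T p ≡ just (node S r cs) → substView r ≡ notSubst r nr →
                      atL cs j [] ≡ just c → newPos T (p ++ [ j ]) ≡ newPos T p ++ [ j ]
  newPos-rule-child T p {cs = cs} j {c} at≡ view≡ c≡ rewrite newPos-++ T p [ j ] at≡ | view≡ =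
    cong (λ q → newPos T p ++ j ∷ q) (trans (newPosL-child cs j [] c≡) (newPos-[] c))

  newPos-subst-child : ∀ T p {S Γ Δ θ c} → at T p ≡ just (node S (subst Γ Δ θ) (c ∷ [])) →
                       newPos T (p ++ [ 0 ]) ≡ newPos T p ++ exitPath (reps Γ Δ θ)
  newPos-subst-child T p {c = c} at≡ rewrite newPos-++ T p [ 0 ] at≡ | newPos-[] c =
    cong (newPos T p ++_) (++-identityʳ _)

  removeSubst-IsNode : ∀ c → WF c → IsNode c → IsNode (removeSubst c)
  removeSubst-IsNode c wf isNode with nodeView c wf
  ... | rule-view S r (_ ∷ _) nr view≡ rewrite view≡ = tt
  ... | subst-view S Γ Δ θ c′ = tt

  removeSubst-bud : ∀ t S → WF t → removeSubst t ≡ bud S → t ≡ bud S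
  removeSubst-bud t S wf t≡ with nodeView t wf
  ... | bud-view S′ = t≡
  ... | rule-view S′ r cs nr view≡ rewrite view≡ with t≡
  ...   | ()
  removeSubst-bud t S wf () | subst-view S′ Γ Δ θ c

  data Origin (T : Tree) (q : List ℕ) (X : Tree) : Set where
    image : ∀ p {t} → at T p ≡ just t → q ≡ newPos T p → X ≡ removeSubst t → Origin T q X
    inner : ∀ p {S Γ Δ θ c} → at T p ≡ just (node S (subst Γ Δ θ) (c ∷ [])) →
            ∀ d → d < spineLength (reps Γ Δ θ) → q ≡ newPos T p ++ spinePath (reps Γ Δ θ) d →
            X ≡ simulateAt (reps Γ Δ θ) (adms Γ Δ θ) Γ Δ (removeSubst c) d → Origin T q X
    dead  : Dead X → Origin T q X

  mutual
    origin : ∀ T → WF T → ∀ q {X} → at (removeSubst T) q ≡ just X → Origin T q X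
    origin (bud S)       _  []      refl = image [] refl refl refl
    origin (bud S)       _  (_ ∷ _) ()
    origin (node S r cs) _  []      refl = image [] refl refl refl
    origin (node S r cs) wf (j ∷ q) {X} at≡ with substView r in view≡
    ... | notSubst r nr = liftChild (originL cs j q (proj₂ (proj₂ wf)) at≡)
      where
        liftChild : Σ[ c ∈ Tree ] atL cs j [] ≡ just c × Origin c q X →
                    Origin (node S r cs) (j ∷ q) X
        liftChild (c , c≡ , image p at≡′ q≡ X≡) =
          image (j ∷ p) (trans (atL-child cs j p c≡) at≡′)
                (trans (cong (j ∷_) q≡) (sym (newPos-rule {S = S} j p view≡ c≡))) X≡
        liftChild (c , c≡ , inner p {Γ = Γ′} {Δ′} {θ′} at≡′ d d< q≡ X≡) =
          inner (j ∷ p) (trans (atL-child cs j p c≡) at≡′) d d<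
                (trans (cong (j ∷_) q≡) (cong (_++ spinePath (reps Γ′ Δ′ θ′) d)
                                              (sym (newPos-rule {S = S} j p view≡ c≡)))) X≡
        liftChild (c , c≡ , dead dead-X) = dead dead-X
    ... | isSubst Γ Δ θ = originSubst cs wf at≡
      where
        originSubst : ∀ cs → WF (node S (subst Γ Δ θ) cs) →
                      at (removeSubstNode S (subst Γ Δ θ) (isSubst Γ Δ θ) (removeSubstL cs)) (j ∷ q)
                        ≡ just X →
                      Origin (node S (subst Γ Δ θ) cs) (j ∷ q) X
        originSubst []          (_ , () , _)     _
        originSubst (_ ∷ _ ∷ _) (_ , _ ∷ () , _) _
        originSubst (c ∷ [])    (_ , _ , wf-c , _) at≡ =
          originSimulate S Γ Δ θ c wf-c (j ∷ q)
            (spineOrigin Γ Δ (removeSubst c) (reps Γ Δ θ) (adms Γ Δ θ) (j ∷ q) X at≡)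

    originSimulate : ∀ S Γ Δ θ c → WF c → ∀ q {X} →
                     SpineOrigin Γ Δ (removeSubst c) (reps Γ Δ θ) (adms Γ Δ θ) q X →
                     Origin (node S (subst Γ Δ θ) (c ∷ [])) q X
    originSimulate S Γ Δ θ c wf-c q (on-spine d d< q≡ X≡) = inner [] refl d d< q≡ X≡
    originSimulate S Γ Δ θ c wf-c q (dead dead-X) = dead dead-X
    originSimulate S Γ Δ θ c wf-c q (below-exit q′ q≡ at≡) with origin c wf-c q′ at≡
    ... | image p at≡′ q′≡ X≡ =
      image (0 ∷ p) at≡′ (trans q≡ (cong (exitPath (reps Γ Δ θ) ++_) q′≡)) X≡
    ... | inner p {Γ = Γ′} {Δ′} {θ′} at≡′ d d< q′≡ X≡ =
      inner (0 ∷ p) at≡′ d d<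
            (trans q≡ (trans (cong (exitPath (reps Γ Δ θ) ++_) q′≡)
                             (sym (++-assoc (exitPath (reps Γ Δ θ)) (newPos c p)
                                            (spinePath (reps Γ′ Δ′ θ′) d))))) X≡
    ... | dead dead-X = dead dead-X

    originL : ∀ cs j q {X} → WFs cs → atL (removeSubstL cs) j q ≡ just X →
              Σ[ c ∈ Tree ] atL cs j [] ≡ just c × Origin c q X
    originL []       j       q _         ()
    originL (c ∷ cs) zero    q (wf , _)  at≡ = c , refl , origin c wf q at≡
    originL (c ∷ cs) (suc j) q (_ , wfs) at≡ = originL cs j q wfs at≡

  length-removeSubstL : ∀ cs → length (removeSubstL cs) ≡ length cs
  length-removeSubstL []       = refl
  length-removeSubstL (c ∷ cs) = cong suc (length-removeSubstL cs)

  removeSubst-rule : ∀ {S S′ ps} {r : Inst S′ ps} {nr} cs → substView r ≡ notSubst r nr →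
                     removeSubst (node S r cs) ≡ node S r (removeSubstL cs)
  removeSubst-rule cs view≡ rewrite view≡ = refl

  child-exists : ∀ cs j → j < length cs → Σ[ c ∈ Tree ] atL cs j [] ≡ just c
  child-exists (c ∷ cs) zero    _        = c , refl
  child-exists (c ∷ cs) (suc j) (s≤s j<) = child-exists cs j j<

  IsNode⇒≢bud : ∀ {X S} → IsNode X → X ≢ bud S
  IsNode⇒≢bud {node _ _ _} _ ()

module SpineTraces (sig : Signature) (Φ : CLKID.InductiveDefs sig) where
  open CLKID sig
  open Rules Φ
  open Substitution sig
  open Replacement sig
  open Elimination sig Φ
  open Positions sig Φ

  -- the trace along a spine that leaves it with the formula F
  spineFormula : List Replacement → ℕ → Formula 0 → Formula 0
  spineFormula []       _                   F = F
  spineFormula (r ∷ rs) 0                   F = replaceF (r ∷ rs) F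
  spineFormula (r ∷ rs) 1                   F = replaceF (r ∷ rs) F
  spineFormula (r ∷ rs) 2                   F = replaceF (r ∷ rs) F
  spineFormula (_ ∷ rs) (suc (suc (suc d))) F = spineFormula rs d F

  spineFormula-0 : ∀ rs F → spineFormula rs 0 F ≡ replaceF rs F
  spineFormula-0 []      F = refl
  spineFormula-0 (_ ∷ _) F = refl

  spineFormula-end : ∀ rs F → spineFormula rs (spineLength rs) F ≡ F
  spineFormula-end []       F = refl
  spineFormula-end (_ ∷ rs) F = spineFormula-end rs F

  IsIndAtom-substF : ∀ σ {F} → IsIndAtom F → IsIndAtom (substF σ F)
  IsIndAtom-substF σ (P , us , refl) = P , substTs σ us , refl

  IsIndAtom-replaceF : ∀ rs {F} → IsIndAtom F → IsIndAtom (replaceF rs F)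
  IsIndAtom-replaceF []             atom = atom
  IsIndAtom-replaceF ((v , s) ∷ rs) atom = IsIndAtom-substF (v ↦ s) (IsIndAtom-replaceF rs atom)

  IsIndAtom-spineFormula : ∀ rs d {F} → IsIndAtom F → IsIndAtom (spineFormula rs d F)
  IsIndAtom-spineFormula []       d                   atom = atom
  IsIndAtom-spineFormula (r ∷ rs) 0                   atom = IsIndAtom-replaceF (r ∷ rs) atom
  IsIndAtom-spineFormula (r ∷ rs) 1                   atom = IsIndAtom-replaceF (r ∷ rs) atom
  IsIndAtom-spineFormula (r ∷ rs) 2                   atom = IsIndAtom-replaceF (r ∷ rs) atom
  IsIndAtom-spineFormula (_ ∷ rs) (suc (suc (suc d))) atom = IsIndAtom-spineFormula rs d atom

  spineFormula-∈ : ∀ Γ Δ c {F} → F ∈ Γ → ∀ rs as d → d < spineLength rs →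
                   spineFormula rs d F ∈ ante (concl (simulateAt rs as Γ Δ c d))
  spineFormula-∈ Γ Δ c F∈Γ (r ∷ rs) _  0 _ = ∈-replaceL (r ∷ rs) F∈Γ
  spineFormula-∈ Γ Δ c F∈Γ (r ∷ rs) _  1 _ = there (∈-replaceL (r ∷ rs) F∈Γ)
  spineFormula-∈ Γ Δ c F∈Γ (r ∷ rs) _  2 _ = there (∈-replaceL (r ∷ rs) F∈Γ)
  spineFormula-∈ Γ Δ c F∈Γ (_ ∷ rs) as (suc (suc (suc d))) (s≤s (s≤s (s≤s d<))) =
    spineFormula-∈ Γ Δ c F∈Γ rs (All.tail as) d d<

  spine-trace : ∀ Γ Δ c rs as d comp p q F → d < spineLength rs → q ≡ p ++ [ spineDir d ] →
                TraceEdgeAt (just (simulateAt rs as Γ Δ c d)) comp p q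
                            (spineFormula rs d F) (spineFormula rs (suc d) F) false
  spine-trace Γ Δ c (_ ∷ rs)       as 0 comp p q F _ q≡ = 1 , s≤s (s≤s z≤n) , q≡ , refl , refl
  spine-trace Γ Δ c (_ ∷ rs)       as 1 comp p q F _ q≡ = 0 , s≤s z≤n , q≡ , refl , refl
  spine-trace Γ Δ c ((v , s) ∷ rs) as 2 comp p q F _ q≡ =
    0 , s≤s z≤n , q≡ , refl , replaceF rs F , refl ,
    trans (spineFormula-0 rs F) (sym (substF-restore v s (replaceF rs F)))
  spine-trace Γ Δ c (_ ∷ rs)       as (suc (suc (suc d))) comp p q F (s≤s (s≤s (s≤s d<))) q≡ =
    spine-trace Γ Δ c rs (All.tail as) d comp p q F d< q≡

  -- One step of the old path, from a node with view w, becomes segmentLength w steps of the new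
  -- path.  If τ and τ₁ are the old trace at both ends of the step, the lifted trace at offset o of
  -- the segment is segmentTrace w o τ τ₁, and it can progress only at offset 0.
  segmentLength : ∀ {t} → NodeView t → ℕ
  segmentLength (bud-view _)           = 1
  segmentLength (rule-view _ _ _ _ _)  = 1
  segmentLength (subst-view _ Γ Δ θ _) = spineLength (reps Γ Δ θ)

  segmentLength>0 : ∀ {t} (w : NodeView t) → 0 < segmentLength w
  segmentLength>0 (bud-view _)           = s≤s z≤n
  segmentLength>0 (rule-view _ _ _ _ _)  = s≤s z≤n
  segmentLength>0 (subst-view _ Γ Δ θ _) = s≤s z≤n

  segmentFormula : ∀ {t} → NodeView t → ℕ → Formula 0 → Formula 0
  segmentFormula (subst-view _ Γ Δ θ _) d F = spineFormula (reps Γ Δ θ) d F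
  segmentFormula _                      _ F = F

  segmentFormula-end : ∀ {t} (w : NodeView t) F → segmentFormula w (segmentLength w) F ≡ F
  segmentFormula-end (bud-view _)           F = refl
  segmentFormula-end (rule-view _ _ _ _ _)  F = refl
  segmentFormula-end (subst-view _ Γ Δ θ _) F = spineFormula-end (reps Γ Δ θ) F

  segmentTrace : ∀ {t} → NodeView t → ℕ → Formula 0 → Formula 0 → Formula 0
  segmentTrace w zero    τ τ₁ = τ
  segmentTrace w (suc o) τ τ₁ = segmentFormula w (suc o) τ₁

  segmentProgress : ℕ → Bool → Bool
  segmentProgress zero    b = b
  segmentProgress (suc _) b = false

module SubstFreePreProof (sig : Signature) (Φ : CLKID.InductiveDefs sig)
                         {S₀ : CLKID.Seq sig} (D : CLKID.Rules.PreProof sig Φ S₀) where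
  open CLKID sig
  open Rules Φ
  open Elimination sig Φ
  open Positions sig Φ

  T₀ T′ : Tree
  T₀ = tree D
  T′ = removeSubst T₀

  wf₀ : WF T₀
  wf₀ = wf D

  companion′ : List ℕ → List ℕ
  companion′ q = newPos T₀ (comp D (oldPos T₀ q))

  companion′-ok : ∀ q S → at T′ q ≡ just (bud S) → CompanionOK T′ (companion′ q) S
  companion′-ok q S at≡ with origin T₀ wf₀ q at≡
  ... | inner p {Γ = Γ} {Δ} {θ} {c} _ d d< _ X≡ =
    ⊥-elim (IsNode⇒≢bud (simulateAt-IsNode Γ Δ (removeSubst c) (reps Γ Δ θ) (adms Γ Δ θ) d d<)
                        (sym X≡))
  ... | dead ()
  ... | image p {t} at≡p refl X≡ with removeSubst-bud t S (WF-at T₀ p wf₀ at≡p) (sym X≡)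
  ...   | refl with compOK D p S at≡p
  ...     | c , at≡c , isNode , c≈ rewrite proj₂ (newPos-sound T₀ p at≡p wf₀) =
    removeSubst c , proj₁ (newPos-sound T₀ (comp D p) at≡c wf₀) ,
    removeSubst-IsNode c wf-c isNode , ≈S-trans (proj₂ (removeSubst-WF c wf-c)) c≈
    where wf-c = WF-at T₀ (comp D p) wf₀ at≡c

  substFree : PreProof S₀
  substFree = record
    { tree    = T′
    ; wf      = proj₁ (removeSubst-WF T₀ wf₀)
    ; rootSeq = ≈S-trans (proj₂ (removeSubst-WF T₀ wf₀)) (rootSeq D)
    ; comp    = companion′
    ; compOK  = companion′-ok
    }

module PathLifting (sig : Signature) (Φ : CLKID.InductiveDefs sig)
                   {S₀ : CLKID.Seq sig} (D : CLKID.Rules.PreProof sig Φ S₀) (π : ℕ → List ℕ)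
                   (path : CLKID.Rules.IsInfinitePath sig Φ (SubstFreePreProof.substFree sig Φ D) π) where
  open CLKID sig
  open Rules Φ
  open Replacement sig
  open Elimination sig Φ
  open Positions sig Φ
  open SpineTraces sig Φ
  open SubstFreePreProof sig Φ D

  edge-at : ∀ i {X} → at T′ (π i) ≡ just X → EdgeAt (just X) companion′ (π i) (π (suc i))
  edge-at i at≡ = ≡-subst (λ m → EdgeAt m companion′ (π i) (π (suc i))) at≡ (path i)

  no-leaf : ∀ i {S S′ ps} {r : Inst S′ ps} → at T′ (π i) ≡ just (node S r []) → ⊥
  no-leaf i at≡ with edge-at i at≡
  ... | _ , () , _

  no-dead : ∀ i {X} → at T′ (π i) ≡ just X → Dead X → ⊥
  no-dead i at≡ (leaf-dead S r) = no-leaf i at≡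
  no-dead i at≡ (∃-refl-dead A B s) with edge-at i at≡
  ... | 0     , _      , q≡ = no-leaf (suc i) (trans (cong (at T′) q≡) (at-++ T′ (π i) [ 0 ] at≡))
  ... | suc _ , s≤s () , _

  at-image : ∀ {i p t} → π i ≡ newPos T₀ p → at T₀ p ≡ just t →
             at T′ (π i) ≡ just (removeSubst t)
  at-image {p = p} π≡ at≡ = trans (cong (at T′) π≡) (proj₁ (newPos-sound T₀ p at≡ wf₀))

  module Spine (p : List ℕ) {S Γ Δ θ c} (at≡ : at T₀ p ≡ just (node S (subst Γ Δ θ) (c ∷ [])))
               where
    rs = reps Γ Δ θ
    L  = spineLength rs

    At : ℕ → ℕ → Set
    At i d = π i ≡ newPos T₀ p ++ spinePath rs d

    start : ∀ {i} → π i ≡ newPos T₀ p → At i 0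
    start π≡ = trans π≡ (sym (trans (cong (newPos T₀ p ++_) (spinePath-0 rs)) (++-identityʳ _)))

    at-spine : ∀ {i} d → At i d →
               at T′ (π i) ≡ just (simulateAt rs (adms Γ Δ θ) Γ Δ (removeSubst c) d)
    at-spine d π≡ =
      trans (cong (at T′) π≡)
            (trans (at-++ T′ (newPos T₀ p) (spinePath rs d) (proj₁ (newPos-sound T₀ p at≡ wf₀)))
                   (at-spinePath Γ Δ (removeSubst c) rs (adms Γ Δ θ) d))

    step-dir : ∀ i d → d < L → At i d → π (suc i) ≡ π i ++ [ spineDir d ]
    step-dir i d d< π≡
      with spine-edge Γ Δ (removeSubst c) rs (adms Γ Δ θ) d companion′ (π i) (π (suc i)) d<
                      (edge-at i (at-spine d π≡))
    ... | inj₁ q≡ = q≡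
    ... | inj₂ (X , q≡ , at≡X , dead-X) =
      ⊥-elim (no-dead (suc i) (trans (cong (at T′) q≡)
                                     (trans (at-++ T′ (π i) [ 0 ] (at-spine d π≡)) at≡X))
                      dead-X)

    step : ∀ i d → d < L → At i d → At (suc i) (suc d)
    step i d d< π≡ = begin
      π (suc i)                                         ≡⟨ step-dir i d d< π≡ ⟩
      π i ++ [ spineDir d ]                             ≡⟨ cong (_++ [ spineDir d ]) π≡ ⟩
      (newPos T₀ p ++ spinePath rs d) ++ [ spineDir d ] ≡⟨ ++-assoc (newPos T₀ p) _ _ ⟩
      newPos T₀ p ++ spinePath rs d ++ [ spineDir d ]   ≡⟨ cong (newPos T₀ p ++_)
                                                                (spinePath-suc rs d d<) ⟨
      newPos T₀ p ++ spinePath rs (suc d)               ∎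
      where open ≡-Reasoning

    run : ∀ i d e → d + e ≤ L → At i d → At (i + e) (d + e)
    run i d zero    _     π≡ rewrite +-identityʳ i | +-identityʳ d = π≡
    run i d (suc e) d+e≤L π≡ rewrite +-suc i e | +-suc d e =
      run (suc i) (suc d) e d+e≤L (step i d (≤-trans (s≤s (m≤m+n d e)) d+e≤L) π≡)

    child-at : at T₀ (p ++ [ 0 ]) ≡ just c
    child-at = at-++ T₀ p [ 0 ] at≡

    exit : ∀ i d → d ≤ L → At i d → π (i + (L ∸ d)) ≡ newPos T₀ (p ++ [ 0 ])
    exit i d d≤L π≡ = begin
      π (i + (L ∸ d))                           ≡⟨ run i d (L ∸ d) (≤-reflexive d+[L∸d]≡L) π≡ ⟩
      newPos T₀ p ++ spinePath rs (d + (L ∸ d)) ≡⟨ cong (λ e → newPos T₀ p ++ spinePath rs e)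
                                                       d+[L∸d]≡L ⟩
      newPos T₀ p ++ spinePath rs L             ≡⟨ cong (newPos T₀ p ++_) (spinePath-end rs) ⟩
      newPos T₀ p ++ exitPath rs                ≡⟨ newPos-subst-child T₀ p at≡ ⟨
      newPos T₀ (p ++ [ 0 ])                    ∎
      where
        open ≡-Reasoning
        d+[L∸d]≡L = m+[n∸m]≡n d≤L

  enters-image : Σ[ m ∈ ℕ ] Σ[ p ∈ List ℕ ] Σ[ t ∈ Tree ]
                 π m ≡ newPos T₀ p × at T₀ p ≡ just t
  enters-image with at T′ (π 0) in at≡ | path 0
  ... | nothing | ()
  ... | just X  | _ with origin T₀ wf₀ (π 0) at≡
  ...   | image p at≡p π≡ _ = 0 , p , _ , π≡ , at≡p
  ...   | dead dead-X = ⊥-elim (no-dead 0 at≡ dead-X)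
  ...   | inner p {c = c} at≡p d d< π≡ _ =
    L ∸ d , p ++ [ 0 ] , c , exit 0 d (<⇒≤ d<) π≡ , child-at
    where open Spine p at≡p

  record Visit : Set where
    constructor visit
    field
      position : List ℕ
      time     : ℕ
      subtree  : Tree
      on-path  : π time ≡ newPos T₀ position
      located  : at T₀ position ≡ just subtree
  open Visit

  viewOf : (v : Visit) → NodeView (subtree v)
  viewOf v = nodeView (subtree v) (WF-at T₀ (position v) wf₀ (located v))

  bud-next : ∀ {g p S} → π g ≡ newPos T₀ p → at T₀ p ≡ just (bud S) →
             π (suc g) ≡ newPos T₀ (comp D p)
  bud-next {g} {p} π≡ at≡ =
    trans (edge-at g (at-image π≡ at≡))
          (cong (newPos T₀ ∘ comp D)
                (trans (cong (oldPos T₀) π≡) (proj₂ (newPos-sound T₀ p at≡ wf₀))))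

  rule-edge : ∀ {g p S S′ ps} {r : Inst S′ ps} {cs nr} → π g ≡ newPos T₀ p →
              at T₀ p ≡ just (node S r cs) → substView r ≡ notSubst r nr →
              Σ[ j ∈ ℕ ] j < length cs × π (suc g) ≡ π g ++ [ j ]
  rule-edge {g} {cs = cs} π≡ at≡ view≡ = j , ≡-subst (j <_) (length-removeSubstL cs) j< , q≡
    where
      E  = edge-at g (trans (at-image π≡ at≡) (cong just (removeSubst-rule cs view≡)))
      j  = proj₁ E
      j< = proj₁ (proj₂ E)
      q≡ = proj₂ (proj₂ E)

  nextFrom : ∀ p g {t} → π g ≡ newPos T₀ p → at T₀ p ≡ just t → NodeView t → Visit
  nextFrom p g π≡ at≡ (bud-view S) =
    visit (comp D p) (suc g) (proj₁ companion) (bud-next π≡ at≡) (proj₁ (proj₂ companion))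
    where companion = compOK D p S at≡
  nextFrom p g π≡ at≡ (rule-view S r cs nr view≡) =
    visit (p ++ [ j ]) (suc g) (proj₁ child)
          (trans q≡ (trans (cong (_++ [ j ]) π≡)
                           (sym (newPos-rule-child T₀ p j at≡ view≡ (proj₂ child)))))
          (trans (at-++ T₀ p [ j ] at≡) (proj₂ child))
    where
      j     = proj₁ (rule-edge π≡ at≡ view≡)
      q≡    = proj₂ (proj₂ (rule-edge π≡ at≡ view≡))
      child = child-exists cs j (proj₁ (proj₂ (rule-edge π≡ at≡ view≡)))
  nextFrom p g π≡ at≡ (subst-view S Γ Δ θ c) =
    visit (p ++ [ 0 ]) (g + spineLength (reps Γ Δ θ)) c (exit g 0 z≤n (start π≡)) child-at
    where open Spine p at≡

  next : Visit → Visit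
  next v = nextFrom (position v) (time v) (on-path v) (located v) (viewOf v)

  time-nextFrom : ∀ p g {t} π≡ at≡ (w : NodeView t) →
                  time (nextFrom p g π≡ at≡ w) ≡ g + segmentLength w
  time-nextFrom p g π≡ at≡ (bud-view S)                = +-comm 1 g
  time-nextFrom p g π≡ at≡ (rule-view S r cs nr view≡) = +-comm 1 g
  time-nextFrom p g π≡ at≡ (subst-view S Γ Δ θ c)      = refl

  old-edge : ∀ p g {t} π≡ at≡ (w : NodeView t) →
             EdgeAt (just t) (comp D) p (position (nextFrom p g π≡ at≡ w))
  old-edge p g π≡ at≡ (bud-view S)                = refl
  old-edge p g π≡ at≡ (rule-view S r cs nr view≡) =
    proj₁ (rule-edge π≡ at≡ view≡) , proj₁ (proj₂ (rule-edge π≡ at≡ view≡)) , refl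
  old-edge p g π≡ at≡ (subst-view S Γ Δ θ c)      = 0 , s≤s z≤n , refl

  TraceStep : List ℕ → List ℕ → Formula 0 → Formula 0 → Bool → Set
  TraceStep P Q τ τ′ b =
    IsIndAtom τ × InAnte T′ P τ × TraceEdgeAt (at T′ P) companion′ P Q τ τ′ b

  TraceStep-cong : ∀ {P Q τ τ₂ τ′ τ₂′ b b₂} → τ ≡ τ₂ → τ′ ≡ τ₂′ → b ≡ b₂ →
                   TraceStep P Q τ₂ τ₂′ b₂ → TraceStep P Q τ τ′ b
  TraceStep-cong refl refl refl step = step

  traceEdge-at : ∀ {P Q X τ τ′ b} → at T′ P ≡ just X →
                 TraceEdgeAt (just X) companion′ P Q τ τ′ b → TraceEdgeAt (at T′ P) companion′ P Q τ τ′ b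
  traceEdge-at {P} {Q} {τ = τ} {τ′} {b} at≡ =
    ≡-subst (λ m → TraceEdgeAt m companion′ P Q τ τ′ b) (sym at≡)

  module _ (p : List ℕ) (g : ℕ) (π≡ : π g ≡ newPos T₀ p) where

    InAnte-image : ∀ {t τ} → at T₀ p ≡ just t → InAnte T₀ p τ → InAnte T′ (π g) τ
    InAnte-image at≡ (t′ , at≡′ , τ∈) with just-injective (trans (sym at≡′) at≡)
    ... | refl = removeSubst t′ , at-image π≡ at≡ ,
                 proj₂ (proj₁ (proj₂ (removeSubst-WF t′ (WF-at T₀ p wf₀ at≡)))) τ∈

    bud-trace : ∀ {S τ τ₁ b} (at≡ : at T₀ p ≡ just (bud S)) → IsIndAtom τ → InAnte T₀ p τ →
                TraceEdgeAt (just (bud S)) (comp D) p (comp D p) τ τ₁ b →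
                TraceStep (π g) (π (suc g)) τ τ₁ b
    bud-trace at≡ atom τ∈ (_ , τ≡ , b≡) =
      atom , InAnte-image at≡ τ∈ ,
      traceEdge-at (at-image π≡ at≡) (edge-at g (at-image π≡ at≡) , τ≡ , b≡)

    rule-trace : ∀ {S S′ ps} {r : Inst S′ ps} {cs nr τ τ₁ b}
                 (at≡ : at T₀ p ≡ just (node S r cs)) (view≡ : substView r ≡ notSubst r nr) →
                 IsIndAtom τ → InAnte T₀ p τ →
                 TraceEdgeAt (just (node S r cs)) (comp D) p
                             (p ++ [ proj₁ (rule-edge π≡ at≡ view≡) ]) τ τ₁ b →
                 TraceStep (π g) (π (suc g)) τ τ₁ b
    rule-trace {cs = cs} at≡ view≡ atom τ∈ (_ , _ , p≡ , pair) with ∷ʳ-injective p p p≡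
    ... | _ , refl = atom , InAnte-image at≡ τ∈ ,
                     traceEdge-at at≡′ (proj₁ E , proj₁ (proj₂ E) , proj₂ (proj₂ E) , pair)
      where
        at≡′ = trans (at-image π≡ at≡) (cong just (removeSubst-rule cs view≡))
        E    = edge-at g at≡′

    premise-ante : ∀ {S Γ Δ θ c τ₁} → at T₀ p ≡ just (node S (subst Γ Δ θ) (c ∷ [])) →
                   InAnte T₀ (p ++ [ 0 ]) τ₁ → τ₁ ∈ Γ
    premise-ante at≡ (c′ , at≡′ , τ₁∈)
      with just-injective (trans (sym at≡′) (Spine.child-at p at≡)) | WF-at T₀ p wf₀ at≡
    ... | refl | _ , c≈ ∷ [] , _ = proj₁ (proj₁ c≈) τ₁∈

    -- the old trace pair of (Subst) says τ = θ τ₁, and θ τ₁ is what the whole spine computes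
    cut-trace : ∀ {S Γ Δ θ c τ τ₁ b}
                (at≡ : at T₀ p ≡ just (node S (subst Γ Δ θ) (c ∷ []))) →
                IsIndAtom τ → InAnte T₀ p τ →
                TraceEdgeAt (just (node S (subst Γ Δ θ) (c ∷ []))) (comp D) p (p ++ [ 0 ]) τ τ₁ b →
                InAnte T₀ (p ++ [ 0 ]) τ₁ →
                TraceStep (π g) (π (suc g)) τ (replaceF (reps Γ Δ θ) τ₁) b
    cut-trace {Γ = Γ} {Δ} {θ} at≡ atom τ∈ (0 , _ , _ , b≡ , τ≡) τ₁∈ =
      atom , InAnte-image at≡ τ∈ ,
      traceEdge-at (at-image π≡ at≡)
        (1 , s≤s (s≤s z≤n) , step-dir g 0 (s≤s z≤n) (start π≡) , b≡ ,
         trans τ≡ (sym (replacementsFor-soundF Γ Δ θ (premise-ante at≡ τ₁∈))))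
      where open Spine p at≡
    cut-trace at≡ atom τ∈ (suc _ , s≤s () , _) τ₁∈

    spine-step-trace : ∀ {S Γ Δ θ c τ₁} (at≡ : at T₀ p ≡ just (node S (subst Γ Δ θ) (c ∷ []))) →
                       ∀ o → o < spineLength (reps Γ Δ θ) → IsIndAtom τ₁ → τ₁ ∈ Γ →
                       let rs = reps Γ Δ θ in
                       TraceStep (π (g + o)) (π (suc (g + o)))
                                 (spineFormula rs o τ₁) (spineFormula rs (suc o) τ₁) false
    spine-step-trace {Γ = Γ} {Δ} {θ} {c} {τ₁} at≡ o o< atom₁ τ₁∈Γ =
      IsIndAtom-spineFormula rs o atom₁ ,
      (_ , at-spine o π≡o , spineFormula-∈ Γ Δ (removeSubst c) τ₁∈Γ rs (adms Γ Δ θ) o o<) ,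
      traceEdge-at (at-spine o π≡o)
        (spine-trace Γ Δ (removeSubst c) rs (adms Γ Δ θ) o companion′ _ _ τ₁ o<
                     (step-dir (g + o) o o< π≡o))
      where
        open Spine p at≡
        π≡o = run g 0 o (<⇒≤ o<) (start π≡)

  segment-trace : ∀ p g {t} π≡ at≡ (w : NodeView t) o → o < segmentLength w → ∀ {τ τ₁ b} →
                  IsIndAtom τ → InAnte T₀ p τ →
                  TraceEdgeAt (just t) (comp D) p (position (nextFrom p g π≡ at≡ w)) τ τ₁ b →
                  IsIndAtom τ₁ → InAnte T₀ (position (nextFrom p g π≡ at≡ w)) τ₁ →
                  TraceStep (π (g + o)) (π (suc (g + o)))
                            (segmentTrace w o τ τ₁) (segmentFormula w (suc o) τ₁) (segmentProgress o b)
  segment-trace p g π≡ at≡ (bud-view S) zero _ atom τ∈ old _ _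
    rewrite +-identityʳ g = bud-trace p g π≡ at≡ atom τ∈ old
  segment-trace p g π≡ at≡ (rule-view S r cs nr view≡) zero _ atom τ∈ old _ _
    rewrite +-identityʳ g = rule-trace p g π≡ at≡ view≡ atom τ∈ old
  segment-trace p g π≡ at≡ (subst-view S Γ Δ θ c) zero _ atom τ∈ old _ τ₁∈
    rewrite +-identityʳ g = cut-trace p g π≡ at≡ atom τ∈ old τ₁∈
  segment-trace p g π≡ at≡ (subst-view S Γ Δ θ c) (suc o) o< _ _ _ atom₁ τ₁∈ =
    spine-step-trace p g π≡ at≡ (suc o) o< atom₁ (premise-ante p g π≡ at≡ τ₁∈)
  segment-trace p g π≡ at≡ (bud-view S)                (suc o) (s≤s ())
  segment-trace p g π≡ at≡ (rule-view S r cs nr view≡) (suc o) (s≤s ())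

  -- Collapsing each segment of π to its first node gives an infinite path of the old pre-proof.
  module Lifted (v₀ : Visit) (gtc : GlobalTraceCondition D) where
    visits : ℕ → Visit
    visits zero    = v₀
    visits (suc n) = next (visits n)

    w : ∀ n → NodeView (subtree (visits n))
    w n = viewOf (visits n)

    open Segments (time v₀) (λ n → segmentLength (w n)) (λ n → segmentLength>0 (w n))

    time≡offset : ∀ n → time (visits n) ≡ offset n
    time≡offset zero    = refl
    time≡offset (suc n) =
      trans (time-nextFrom _ _ _ _ (w n)) (cong (_+ segmentLength (w n)) (time≡offset n))

    oldPath : ℕ → List ℕ
    oldPath n = position (visits n)

    oldPath-infinite : IsInfinitePath D oldPath
    oldPath-infinite n = ≡-subst (λ m → EdgeAt m (comp D) (oldPath n) (oldPath (suc n)))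
                                 (sym (located (visits n))) (old-edge _ _ _ _ (w n))

    k : ℕ
    k = proj₁ (gtc oldPath oldPath-infinite)

    τ : ℕ → Formula 0
    τ = proj₁ (proj₂ (gtc oldPath oldPath-infinite))

    b : ℕ → Bool
    b = proj₁ (proj₂ (proj₂ (gtc oldPath oldPath-infinite)))

    follows : ∀ n → k ≤ n →
              IsIndAtom (τ n) × InAnte T₀ (oldPath n) (τ n) ×
              TraceEdgeAt (at T₀ (oldPath n)) (comp D) (oldPath n) (oldPath (suc n))
                          (τ n) (τ (suc n)) (b n)
    follows = proj₁ (proj₂ (proj₂ (proj₂ (gtc oldPath oldPath-infinite))))

    progressing : ∀ m → Σ[ j ∈ ℕ ] m ≤ j × k ≤ j × b j ≡ true
    progressing = proj₂ (proj₂ (proj₂ (proj₂ (gtc oldPath oldPath-infinite))))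

    traceAt : ℕ × ℕ → Formula 0
    traceAt (n , o) = segmentTrace (w n) o (τ n) (τ (suc n))

    progressAt : ℕ × ℕ → Bool
    progressAt (n , o) = segmentProgress o (b n)

    τ′ : ℕ → Formula 0
    τ′ x = traceAt (locate x)

    b′ : ℕ → Bool
    b′ x = progressAt (locate x)

    next-trace : ∀ n o → o < segmentLength (w n) →
                 τ′ (suc (offset n + o)) ≡ segmentFormula (w n) (suc o) (τ (suc n))
    next-trace n o o< with m≤n⇒m<n∨m≡n o<
    ... | inj₁ 1+o< =
      cong traceAt (trans (cong locate (sym (+-suc (offset n) o))) (locate-inside {n} 1+o<))
    ... | inj₂ 1+o≡ = begin
      τ′ (suc (offset n + o))                    ≡⟨ cong τ′ (trans (sym (+-suc (offset n) o))
                                                                   (cong (offset n +_) 1+o≡)) ⟩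
      τ′ (offset (suc n))                        ≡⟨ cong τ′ (+-identityʳ (offset (suc n))) ⟨
      τ′ (offset (suc n) + 0)                    ≡⟨ cong traceAt (locate-inside {suc n}
                                                                   (segmentLength>0 (w (suc n)))) ⟩
      τ (suc n)                                  ≡⟨ segmentFormula-end (w n) (τ (suc n)) ⟨
      segmentFormula (w n) (segmentLength (w n)) (τ (suc n))
                                                 ≡⟨ cong (λ l → segmentFormula (w n) l (τ (suc n))) 1+o≡ ⟨
      segmentFormula (w n) (suc o) (τ (suc n))   ∎
      where open ≡-Reasoning

    segment-at : ∀ n o → k ≤ n → o < segmentLength (w n) →
                 let x = offset n + o in TraceStep (π x) (π (suc x)) (τ′ x) (τ′ (suc x)) (b′ x)
    segment-at n o k≤n o< =
      TraceStep-cong (cong traceAt inside) (next-trace n o o<) (cong progressAt inside)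
        (≡-subst (λ g → TraceStep (π (g + o)) (π (suc (g + o))) (traceAt (n , o))
                                  (segmentFormula (w n) (suc o) (τ (suc n))) (progressAt (n , o)))
                 (time≡offset n)
                 (segment-trace (position v) (time v) (on-path v) (located v) (w n) o o<
                                (proj₁ now) (proj₁ (proj₂ now)) old-step
                                (proj₁ later) (proj₁ (proj₂ later))))
      where
        v        = visits n
        inside   = locate-inside {n} {o} o<
        now      = follows n k≤n
        later    = follows (suc n) (m≤n⇒m≤1+n k≤n)
        old-step = ≡-subst (λ m → TraceEdgeAt m (comp D) (oldPath n) (oldPath (suc n))
                                              (τ n) (τ (suc n)) (b n))
                           (located v) (proj₂ (proj₂ now))

    lifted : ∀ x → offset k ≤ x → TraceStep (π x) (π (suc x)) (τ′ x) (τ′ (suc x)) (b′ x)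
    lifted x k≤x =
      ≡-subst (λ y → TraceStep (π y) (π (suc y)) (τ′ y) (τ′ (suc y)) (b′ y)) (proj₁ sound)
              (segment-at (proj₁ (locate x)) (proj₂ (locate x)) (locate-≥ k≤x) (proj₂ sound))
      where sound = locate-sound (≤-trans (start≤offset k) k≤x)

    progresses : ∀ m → Σ[ x ∈ ℕ ] m ≤ x × offset k ≤ x × b′ x ≡ true
    progresses m with progressing m
    ... | j , m≤j , k≤j , bj =
      offset j , ≤-trans m≤j (n≤offset j) , offset-mono-≤ k≤j ,
      trans (cong progressAt (trans (cong locate (sym (+-identityʳ (offset j))))
                                    (locate-inside {j} (segmentLength>0 (w j)))))
            bj

    infProgTrace : HasInfProgTrace substFree π
    infProgTrace = offset k , τ′ , b′ , lifted , progresses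

module SubstitutionElimination (sig : Signature) (Φ : CLKID.InductiveDefs sig) where
  open CLKID sig
  open Rules Φ
  open Elimination sig Φ using (removeSubst-SubstFree)
  open SubstFreePreProof sig Φ using (substFree)
  open PathLifting sig Φ using (enters-image; visit; module Lifted)

  substFree-GTC : ∀ {S} (D : PreProof S) → GlobalTraceCondition D →
                  GlobalTraceCondition (substFree D)
  substFree-GTC D gtc π path with enters-image D π path
  ... | m , p , t , π≡ , at≡ = Lifted.infProgTrace D π path (visit p m t π≡ at≡) gtc

  eliminateSubst : ∀ {S} → Provable S → ProvableWithoutSubst S
  eliminateSubst (D , gtc) = substFree D , substFree-GTC D gtc , removeSubst-SubstFree (tree D)

theorem2 : (sig : Signature) (Φ : CLKID.InductiveDefs sig)
    (Γ Δ : List (CLKID.Formula sig 0)) →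
    CLKID.Rules.Provable sig Φ (CLKID._⊢_ Γ Δ) →
    CLKID.Rules.ProvableWithoutSubst sig Φ (CLKID._⊢_ Γ Δ)
theorem2 sig Φ Γ Δ = SubstitutionElimination.eliminateSubst sig Φ
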